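{- For all integers $s \ge 1$ and $t \ge 1$: (i) $EN_{2,t}(321)(q) = q^{\binom{t+1}{2}} \tilde{C}_t(q)$; (ii) $EN_{s,2}(123)(q) = q^{3\binom{s}{2}} C_s(q)$; (iii) $NE_{s,2}(123)(q) = q^{\frac{s(3s-1)}{2}} C_s(q)$; (iv) $NE_{2,t}(123)(q) = q^{\frac{t(3t-1)}{2}} \tilde{C}_t(q)$.
   Context: For positive integers $s,t$, write each $x \in [st]$ uniquely as $x=(j-1)t+r$ with $1\le j\le s$, $1\le r\le t$. The poset $EN_{s,t}$ is $[st]$ with $(j-1)t+r \preceq (j'-1)t+r'$ iff $j'\le j$ and $r\le r'$; the poset $NE_{s,t}$ is $[st]$ with $(j-1)t+r \preceq (j'-1)t+r'$ iff $j'\le j$ and $r'\le r$. A linear extension of a poset $([n],\preceq)$ is a permutation $\pi$ of $[n]$ in one-line notation such that whenever $a\preceq b$, $a\ne b$, $a$ appears before $b$. $\pi$ avoids $\sigma$ if it has no subsequence with the same relative order as $\sigma$; $P(\sigma)$ is the set of linear extensions of $P$ avoiding $\sigma$. An inversion of a finite integer sequence $w$ is a pair of positions $i<j$ with $w(i)>w(j)$; $\mathrm{inv}(w)$ is the number of inversions. $P(\sigma)(q)=\sum_{\pi\in P(\sigma)} q^{\mathrm{inv}(\pi)}$. A Catalan word of length $2n$ is a sequence of $n$ $0$s and $n$ $1$s in which every initial segment has at least as many $0$s as $1$s; $CW_n$ is the set of these. $C_n(q)=\sum_{w\in CW_n} q^{\mathrm{inv}(w)}$ and $\tilde C_n(q)=q^{\binom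 n2}C_n(q^{ -1})$. -}

module Defs where

open import Data.Bool using (Bool; true; false; _∧_; _∨_; not; if_then_else_)
open import Data.Nat using (ℕ; zero; suc; _+_; _*_; _∸_; _<ᵇ_; _≡ᵇ_)
open import Data.Nat.DivMod using (_/_; _%_)
open import Data.Bool.ListAction using (all; any)
open import Data.Integer as ℤ using (ℤ; +_; -_)
open import Data.List using (List; []; _∷_; map; filter; concatMap; length; upTo; _++_; replicate; sum)
open import Data.List.Relation.Binary.Permutation.Propositional using (_↭_)
open import Relation.Nullary.Decidable using (Dec; yes; no)
open import Relation.Binary.PropositionalEquality using (_≡_)
open import Data.Bool.Properties using () renaming (_≟_ to _≟ᵇ_)

range1 : ℕ → List ℕ
range1 n = map suc (upTo n)

insertions : ℕ → List ℕ → List (List ℕ)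
insertions x []       = (x ∷ []) ∷ []
insertions x (y ∷ ys) = (x ∷ y ∷ ys) ∷ map (y ∷_) (insertions x ys)

perms : List ℕ → List (List ℕ)
perms []       = [] ∷ []
perms (x ∷ xs) = concatMap (insertions x) (perms xs)

subseqs : List ℕ → List (List ℕ)
subseqs []       = [] ∷ []
subseqs (x ∷ xs) = let r = subseqs xs in map (x ∷_) r ++ r

_==_ : Bool → Bool → Bool
true  == b = b
false == b = not b

sameOrder : List ℕ → List ℕ → Bool
sameOrder []       []       = true
sameOrder (a ∷ as) (b ∷ bs) =
  pairs as bs ∧ sameOrder as bs
  where
  pairs : List ℕ → List ℕ → Bool
  pairs []       []       = true
  pairs (c ∷ cs) (d ∷ ds) = ((a <ᵇ c) == (b <ᵇ d)) ∧ ((c <ᵇ a) == (d <ᵇ b)) ∧ pairs cs ds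
  pairs _        _        = false
sameOrder _        _        = false

contains : List ℕ → List ℕ → Bool
contains σ π = any (sameOrder σ) (subseqs π)

avoids : List ℕ → List ℕ → Bool
avoids σ π = not (contains σ π)

inv : List ℕ → ℕ
inv []       = 0
inv (x ∷ xs) = length (filter (λ y → y Data.Nat.<? x) xs) + inv xs

-- x ∈ [st] is written x = (j-1)t + r ; we compute j-1 and r-1 (0-based)
blk : (t : ℕ) → ℕ → ℕ
blk zero    x = 0
blk (suc t) x = (x ∸ 1) / suc t

pos : (t : ℕ) → ℕ → ℕ
pos zero    x = 0
pos (suc t) x = (x ∸ 1) % suc t

_≤ᵇ_ : ℕ → ℕ → Bool
m ≤ᵇ n = m <ᵇ suc n

EN≼ : (t : ℕ) → ℕ → ℕ → Bool
EN≼ t x y = (blk t y ≤ᵇ blk t x) ∧ (pos t x ≤ᵇ pos t y)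

NE≼ : (t : ℕ) → ℕ → ℕ → Bool
NE≼ t x y = (blk t y ≤ᵇ blk t x) ∧ (pos t y ≤ᵇ pos t x)

-- π is a linear extension of ⪯ : whenever a ⪯ b, a ≠ b, a appears before b.
-- For a permutation this says: for all positions i < j, not (π(j) ⪯ π(i)).
isLinExt : (ℕ → ℕ → Bool) → List ℕ → Bool
isLinExt R []       = true
isLinExt R (x ∷ xs) = all (λ y → not (R y x)) xs ∧ isLinExt R xs

-- Laurent polynomials with nonnegative integer coefficients, represented
-- by the multiset (list) of exponents of their monomials; two such
-- polynomials are equal iff the lists are permutations of each other.

Poly : Set
Poly = List ℤ

_≈P_ : Poly → Poly → Set
p ≈P q = p ↭ q

shift : ℤ → Poly → Poly
shift m = map (λ e → m ℤ.+ e)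

invert : Poly → Poly
invert = map (-_)

genfun : (n : ℕ) → (ℕ → ℕ → Bool) → List ℕ → Poly
genfun n R σ =
  map (λ π → + inv π)
      (filter (λ π → (isLinExt R π ∧ avoids σ π) ≟ᵇ true) (perms (range1 n)))

EN : (s t : ℕ) → List ℕ → Poly
EN s t σ = genfun (s * t) (EN≼ t) σ

NE : (s t : ℕ) → List ℕ → Poly
NE s t σ = genfun (s * t) (NE≼ t) σ

words01 : ℕ → List (List ℕ)
words01 zero    = [] ∷ []
words01 (suc m) = let r = words01 m in map (0 ∷_) r ++ map (1 ∷_) r

-- every initial segment has at least as many 0s as 1s; d = (#0s - #1s) so far
ballot : ℕ → List ℕ → Bool
ballot d []            = true
ballot d (zero ∷ w)    = ballot (suc d) w
ballot zero (suc _ ∷ w) = false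
ballot (suc d) (suc _ ∷ w) = ballot d w

count : ℕ → List ℕ → ℕ
count a w = length (filter (λ b → a Data.Nat.≟ b) w)

isCatalan : ℕ → List ℕ → Bool
isCatalan n w = (count 0 w ≡ᵇ n) ∧ (count 1 w ≡ᵇ n) ∧ ballot 0 w

CW : ℕ → List (List ℕ)
CW n = filter (λ w → isCatalan n w ≟ᵇ true) (words01 (2 * n))

binom2 : ℕ → ℕ
binom2 n = (n * (n ∸ 1)) / 2

Cq : ℕ → Poly
Cq n = map (λ w → + inv w) (CW n)

Ctq : ℕ → Poly
Ctq n = shift (+ binom2 n) (invert (Cq n))

-- Every linear extension of these four posets is a "ballot merge" of two chains: reading its Catalan
-- word from left to right, each 0 takes the next element of the lower chain and each 1 the next element
-- of the upper one (the lower chain's k-th element lies below the upper chain's k′-th iff k ≤ k′).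
-- Such a merge is automatically σ-avoiding, since each chain is monotone in value in the direction that
-- forbids σ and any three entries contain two from the same chain.  So P(σ) is in bijection with CW_n,
-- and it remains to compare inversions: counting, for every entry, the smaller entries still to come
-- gives a closed form for inv(merge w) in terms of inv w, the offset being a triangular or pentagonal
-- number (and the sign of inv w telling C_n from C̃_n).
module Submission where

open import Defs
open import Data.Bool using (Bool; true; false; _∧_; not; T)
open import Data.Bool.ListAction using (all; any)
open import Data.Bool.Properties using (T-≡; not-involutive; ∧-identityʳ; ∧-zeroʳ) renaming (_≟_ to _≟ᵇ_)
open import Data.Integer using (+_)
import Data.Integer as ℤ
import Data.Integer.Properties as ℤ
open import Data.List using (List; []; _∷_; _++_; map; filter; length; applyUpTo; reverse)
open import Data.List.Membership.Propositional using (_∈_; _∉_)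
open import Data.List.Membership.Propositional.Properties
  using (∈-map⁻; ∈-map⁺; ∈-∃++; ∈-concat⁺′; ∈-concat⁻′; ∈-++⁻; ∈-++⁺ˡ; ∈-++⁺ʳ;
         ∈-filter⁺; ∈-filter⁻)
open import Data.List.Membership.Propositional.Properties.WithK using (unique∧set⇒bag)
open import Data.List.Properties
  using (∷-injective; ∷-injectiveʳ; filter-all; filter-none; filter-++; length-++; map-∘; map-cong-local;
         reverse-++)
open import Data.List.Relation.Binary.BagAndSetEquality using (∼bag⇒↭)
open import Data.List.Relation.Binary.Disjoint.Propositional using (Disjoint)
open import Data.List.Relation.Binary.Permutation.Propositional
  using (_↭_; ↭-refl; ↭-sym; ↭-trans; ↭-reflexive; prep; swap; module PermutationReasoning)
open import Data.List.Relation.Binary.Permutation.Propositional.Properties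
  using (∈-resp-↭; ↭-empty-inv; ↭-length; ↭-reverse; drop-∷; drop-mid; filter-↭; map⁺; ++⁺; ++⁺ʳ;
         ++-comm)
  renaming (shift to ↭-shift)
open import Data.List.Relation.Unary.All as All using (All; []; _∷_)
import Data.List.Relation.Unary.All.Properties as All
open import Data.List.Relation.Unary.AllPairs using (AllPairs; []; _∷_)
import Data.List.Relation.Unary.AllPairs.Properties as AllPairs
open import Data.List.Relation.Unary.Any using (here; there)
open import Data.List.Relation.Unary.Unique.Propositional using (Unique)
import Data.List.Relation.Unary.Unique.Propositional.Properties as Unique
open import Data.Nat
  using (ℕ; zero; suc; _+_; _*_; _∸_; _≤_; _<_; _>_; _≤?_; _<?_; _<ᵇ_; _≡ᵇ_; z≤n; s≤s; z<s; s<s)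
open import Data.Nat.Divisibility using (n∣m*n)
open import Data.Nat.DivMod using (_/_; m*n/n≡m; m<n⇒m/n≡0; m<n⇒m%n≡m; +-distrib-/-∣ˡ; %-remove-+ˡ)
open import Data.Nat.Properties
open import Data.Nat.Tactic.RingSolver using (solve-∀)
open import Data.Product using (∃; _×_; _,_; proj₁; proj₂)
open import Data.Sum using (_⊎_; inj₁; inj₂)
open import Function using (_∘_; id; case_of_)
open import Function.Bundles using (_⇔_; mk⇔; Equivalence)
open import Relation.Nullary using (¬_; yes; no; contradiction)
open import Relation.Binary.PropositionalEquality
  using (_≡_; _≢_; refl; sym; trans; cong; cong₂; subst; module ≡-Reasoning)

open import Algebra.Properties.CommutativeSemigroup +-commutativeSemigroup using (x∙yz≈y∙xz)

∈-insertions⇒↭ : ∀ x ρ {π} → π ∈ insertions x ρ → π ↭ x ∷ ρ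
∈-insertions⇒↭ x []       (here refl) = ↭-refl
∈-insertions⇒↭ x (y ∷ ρ)  (here refl) = ↭-refl
∈-insertions⇒↭ x (y ∷ ρ)  (there π∈) with ∈-map⁻ (y ∷_) π∈
... | π , π∈′ , refl = ↭-trans (prep y (∈-insertions⇒↭ x ρ π∈′)) (swap y x ↭-refl)

∈-perms⇒↭ : ∀ xs {π} → π ∈ perms xs → π ↭ xs
∈-perms⇒↭ []       (here refl) = ↭-refl
∈-perms⇒↭ (x ∷ xs) π∈ with ∈-concat⁻′ (map (insertions x) (perms xs)) π∈
... | πs , π∈πs , πs∈ with ∈-map⁻ (insertions x) πs∈
... | ρ , ρ∈ , refl = ↭-trans (∈-insertions⇒↭ x ρ π∈πs) (prep x (∈-perms⇒↭ xs ρ∈))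

insert-∈-insertions : ∀ x ρ₁ ρ₂ → ρ₁ ++ x ∷ ρ₂ ∈ insertions x (ρ₁ ++ ρ₂)
insert-∈-insertions x []       []       = here refl
insert-∈-insertions x []       (y ∷ ρ₂) = here refl
insert-∈-insertions x (y ∷ ρ₁) ρ₂       = there (∈-map⁺ (y ∷_) (insert-∈-insertions x ρ₁ ρ₂))

↭⇒∈-perms : ∀ xs {π} → π ↭ xs → π ∈ perms xs
↭⇒∈-perms []       π↭ rewrite ↭-empty-inv π↭ = here refl
↭⇒∈-perms (x ∷ xs) π↭ with ∈-∃++ (∈-resp-↭ (↭-sym π↭) (here refl))
... | ρ₁ , ρ₂ , refl =
  ∈-concat⁺′ (insert-∈-insertions x ρ₁ ρ₂)
             (∈-map⁺ (insertions x) (↭⇒∈-perms xs (drop-mid ρ₁ [] π↭)))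

remove : ℕ → List ℕ → List ℕ
remove x []       = []
remove x (y ∷ ys) with x ≟ y
... | yes _ = ys
... | no  _ = y ∷ remove x ys

remove-self : ∀ x ρ → remove x (x ∷ ρ) ≡ ρ
remove-self x ρ with x ≟ x
... | yes _   = refl
... | no  x≢x = contradiction refl x≢x

remove-insertions : ∀ x ρ {π} → x ∉ ρ → π ∈ insertions x ρ → remove x π ≡ ρ
remove-insertions x []      _  (here refl) = remove-self x []
remove-insertions x (y ∷ ρ) _  (here refl) = remove-self x (y ∷ ρ)
remove-insertions x (y ∷ ρ) x∉ (there π∈) with ∈-map⁻ (y ∷_) π∈
... | π , π∈′ , refl with x ≟ y
... | yes refl = contradiction (here refl) x∉
... | no  _    = cong (y ∷_) (remove-insertions x ρ (x∉ ∘ there) π∈′)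

insertions-unique : ∀ x ρ → x ∉ ρ → Unique (insertions x ρ)
insertions-unique x []      _  = [] ∷ []
insertions-unique x (y ∷ ρ) x∉ =
  All.tabulate head-fresh ∷ Unique.map⁺ ∷-injectiveʳ (insertions-unique x ρ (x∉ ∘ there))
  where
  head-fresh : ∀ {π} → π ∈ map (y ∷_) (insertions x ρ) → x ∷ y ∷ ρ ≢ π
  head-fresh π∈ eq with ∈-map⁻ (y ∷_) π∈
  head-fresh π∈ refl | _ , _ , refl = x∉ (here refl)

insertions-disjoint : ∀ x {ρ ρ′} → x ∉ ρ → x ∉ ρ′ → ρ ≢ ρ′ →
                      Disjoint (insertions x ρ) (insertions x ρ′)
insertions-disjoint x {ρ} {ρ′} x∉ρ x∉ρ′ ρ≢ρ′ (π∈ , π∈′) =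
  ρ≢ρ′ (trans (sym (remove-insertions x ρ x∉ρ π∈)) (remove-insertions x ρ′ x∉ρ′ π∈′))

perms-unique : ∀ xs → Unique xs → Unique (perms xs)
perms-unique []       _          = [] ∷ []
perms-unique (x ∷ xs) (x∉ ∷ xs!) =
  Unique.concat⁺ (All.map⁺ (All.map (insertions-unique x _) fresh))
                 (AllPairs.map⁺ (pairwise (perms-unique xs xs!) fresh))
  where
  fresh : All (x ∉_) (perms xs)
  fresh = All.tabulate (λ ρ∈ x∈ρ → All.lookup x∉ (∈-resp-↭ (∈-perms⇒↭ xs ρ∈) x∈ρ) refl)
  pairwise : ∀ {ρs} → Unique ρs → All (x ∉_) ρs →
             AllPairs (λ ρ ρ′ → Disjoint (insertions x ρ) (insertions x ρ′)) ρs
  pairwise []          []          = []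
  pairwise (≢s ∷ ρs!) (x∉ρ ∷ x∉ρs) =
    All.zipWith (λ (x∉ρ′ , ρ≢ρ′) {_} → insertions-disjoint x x∉ρ x∉ρ′ ρ≢ρ′) (x∉ρs , ≢s)
    ∷ pairwise ρs! x∉ρs

unique-⇔⇒↭ : ∀ {A : Set} {xs ys : List A} → Unique xs → Unique ys →
             (∀ {z} → z ∈ xs ⇔ z ∈ ys) → xs ↭ ys
unique-⇔⇒↭ xs! ys! eq = ∼bag⇒↭ (unique∧set⇒bag xs! ys! eq)

Unique-map⁺-on : ∀ {A B : Set} (f : A → B) {xs} →
  (∀ {x y} → x ∈ xs → y ∈ xs → f x ≡ f y → x ≡ y) → Unique xs → Unique (map f xs)
Unique-map⁺-on f {[]}     _   _          = []
Unique-map⁺-on f {x ∷ xs} inj (x∉ ∷ xs!) =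
  All.map⁺ (All.tabulate λ y∈ fx≡fy → All.lookup x∉ y∈ (inj (here refl) (there y∈) fx≡fy))
  ∷ Unique-map⁺-on f (λ x∈ y∈ → inj (there x∈) (there y∈)) xs!

range1-unique : ∀ n → Unique (range1 n)
range1-unique n = Unique.map⁺ suc-injective (Unique.upTo⁺ n)

∧-true⁻ : ∀ {a b} → a ∧ b ≡ true → a ≡ true × b ≡ true
∧-true⁻ {true} b≡true = refl , b≡true

all-true⁺ : ∀ (p : ℕ → Bool) xs → (∀ {y} → y ∈ xs → p y ≡ true) → all p xs ≡ true
all-true⁺ p []       _   = refl
all-true⁺ p (x ∷ xs) all rewrite all (here refl) = all-true⁺ p xs (all ∘ there)

all-true⁻ : ∀ (p : ℕ → Bool) xs → all p xs ≡ true → ∀ {y} → y ∈ xs → p y ≡ true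
all-true⁻ p (x ∷ xs) eq (here refl) = proj₁ (∧-true⁻ eq)
all-true⁻ p (x ∷ xs) eq (there y∈)  = all-true⁻ p xs (proj₂ (∧-true⁻ {p x} eq)) y∈

any-false⁺ : ∀ (p : List ℕ → Bool) xs → (∀ {y} → y ∈ xs → p y ≡ false) → any p xs ≡ false
any-false⁺ p []       _    = refl
any-false⁺ p (x ∷ xs) none rewrite none (here refl) = any-false⁺ p xs (none ∘ there)

≤ᵇ-true⇒≤ : ∀ {a b} → (a ≤ᵇ b) ≡ true → a ≤ b
≤ᵇ-true⇒≤ {a} {b} eq = ≤-pred (<ᵇ⇒< a (suc b) (Equivalence.from T-≡ eq))

≤⇒≤ᵇ-true : ∀ {a b} → a ≤ b → (a ≤ᵇ b) ≡ true
≤⇒≤ᵇ-true a≤b = Equivalence.to T-≡ (<⇒<ᵇ (s≤s a≤b))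

>⇒≤ᵇ-false : ∀ {a b} → b < a → (a ≤ᵇ b) ≡ false
>⇒≤ᵇ-false {a} {b} b<a with a ≤ᵇ b in eq
... | false = refl
... | true  = contradiction (≤ᵇ-true⇒≤ eq) (<⇒≱ b<a)

∸≡suc[∸suc] : ∀ {i m} → i < m → m ∸ i ≡ suc (m ∸ suc i)
∸≡suc[∸suc] {zero}  {suc m} _       = refl
∸≡suc[∸suc] {suc i} {suc m} (s≤s i<m) = ∸≡suc[∸suc] i<m

segment : (ℕ → ℕ) → ℕ → ℕ → List ℕ
segment f i zero    = []
segment f i (suc a) = f i ∷ segment f (suc i) a

length-segment : ∀ f i a → length (segment f i a) ≡ a
length-segment f i zero    = refl
length-segment f i (suc a) = cong suc (length-segment f (suc i) a)

∈-segment⁻ : ∀ f i a {x} → x ∈ segment f i a → ∃ λ k → i ≤ k × k < i + a × x ≡ f k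
∈-segment⁻ f i (suc a) (here refl) = i , ≤-refl , m<m+n i z<s , refl
∈-segment⁻ f i (suc a) (there x∈) with ∈-segment⁻ f (suc i) a x∈
... | k , i<k , k<i+1+a , refl = k , <⇒≤ i<k , subst (k <_) (sym (+-suc i a)) k<i+1+a , refl

All-segment : ∀ {P : ℕ → Set} f i a → (∀ k → i ≤ k → k < i + a → P (f k)) → All P (segment f i a)
All-segment f i a P-range = All.tabulate λ x∈ → case ∈-segment⁻ f i a x∈ of λ
  { (k , i≤k , k<i+a , refl) → P-range k i≤k k<i+a }

segment-++ : ∀ f i a b → segment f i (a + b) ≡ segment f i a ++ segment f (i + a) b
segment-++ f i zero    b rewrite +-identityʳ i = refl
segment-++ f i (suc a) b rewrite +-suc i a = cong (f i ∷_) (segment-++ f (suc i) a b)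

segment-shift : ∀ f i a → segment f (suc i) a ≡ segment (f ∘ suc) i a
segment-shift f i zero    = refl
segment-shift f i (suc a) = cong (f (suc i) ∷_) (segment-shift f (suc i) a)

segment-+ : ∀ f i j a → segment f (i + j) a ≡ segment (λ k → f (i + k)) j a
segment-+ f i j zero    = refl
segment-+ f i j (suc a) =
  cong (f (i + j) ∷_) (trans (cong (λ x → segment f x a) (sym (+-suc i j))) (segment-+ f i (suc j) a))

range1≡segment : ∀ n → range1 n ≡ segment suc 0 n
range1≡segment n = go suc id n
  where
  go : ∀ h g n → map h (applyUpTo g n) ≡ segment (h ∘ g) 0 n
  go h g zero    = refl
  go h g (suc n) = cong (h (g 0) ∷_) (trans (go h (g ∘ suc) n) (sym (segment-shift (h ∘ g) 0 n)))

countBelow : ℕ → List ℕ → ℕ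
countBelow x xs = length (filter (_<? x) xs)

countBelow-all : ∀ {x xs} → All (_< x) xs → countBelow x xs ≡ length xs
countBelow-all {x} all< = cong length (filter-all (_<? x) all<)

countBelow-none : ∀ {x xs} → All (x ≤_) xs → countBelow x xs ≡ 0
countBelow-none {x} all≥ = cong length (filter-none (_<? x) (All.map ≤⇒≯ all≥))

countBelow-++ : ∀ x xs ys → countBelow x (xs ++ ys) ≡ countBelow x xs + countBelow x ys
countBelow-++ x xs ys rewrite filter-++ (_<? x) xs ys = length-++ (filter (_<? x) xs)

countBelow-↭ : ∀ x {xs ys} → xs ↭ ys → countBelow x xs ≡ countBelow x ys
countBelow-↭ x xs↭ys = ↭-length (filter-↭ (_<? x) xs↭ys)

countBelow-zero : ∀ xs → countBelow 0 xs ≡ 0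
countBelow-zero []       = refl
countBelow-zero (x ∷ xs) = countBelow-zero xs

countBelow-tail : ∀ f x {i c m} → i ≤ c → c ≤ m →
  (∀ k → i ≤ k → k < c → x ≤ f k) → (∀ k → c ≤ k → k < m → f k < x) →
  countBelow x (segment f i (m ∸ i)) ≡ m ∸ c
countBelow-tail f x {i} {c} {m} i≤c c≤m above below = begin
  countBelow x (segment f i (m ∸ i))
    ≡⟨ cong (countBelow x ∘ segment f i) split ⟩
  countBelow x (segment f i ((c ∸ i) + (m ∸ c)))
    ≡⟨ cong (countBelow x) (segment-++ f i (c ∸ i) (m ∸ c)) ⟩
  countBelow x (segment f i (c ∸ i) ++ segment f (i + (c ∸ i)) (m ∸ c))
    ≡⟨ cong (λ j → countBelow x (segment f i (c ∸ i) ++ segment f j (m ∸ c))) (m+[n∸m]≡n i≤c) ⟩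
  countBelow x (segment f i (c ∸ i) ++ segment f c (m ∸ c))
    ≡⟨ countBelow-++ x (segment f i (c ∸ i)) _ ⟩
  countBelow x (segment f i (c ∸ i)) + countBelow x (segment f c (m ∸ c))
    ≡⟨ cong₂ _+_ (countBelow-none (All-segment f i (c ∸ i) λ k i≤k k< → above k i≤k (bound i≤c k<)))
                 (trans (countBelow-all (All-segment f _ (m ∸ c) λ k c≤k k< → below k c≤k (bound c≤m k<)))
                        (length-segment f _ (m ∸ c))) ⟩
  0 + (m ∸ c)
    ∎
  where
  open ≡-Reasoning
  split : m ∸ i ≡ (c ∸ i) + (m ∸ c)
  split = begin
    m ∸ i                 ≡⟨ cong (_∸ i) (m+[n∸m]≡n c≤m) ⟨
    (c + (m ∸ c)) ∸ i     ≡⟨ +-∸-comm (m ∸ c) i≤c ⟩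
    (c ∸ i) + (m ∸ c)     ∎
  bound : ∀ {a b k} → a ≤ b → k < a + (b ∸ a) → k < b
  bound a≤b = subst (_ <_) (m+[n∸m]≡n a≤b)

countBelow-tail-all : ∀ f x {i m} → i ≤ m → (∀ k → i ≤ k → k < m → f k < x) →
  countBelow x (segment f i (m ∸ i)) ≡ m ∸ i
countBelow-tail-all f x i≤m below =
  countBelow-tail f x ≤-refl i≤m (λ k i≤k k<i → contradiction i≤k (<⇒≱ k<i)) below

countBelow-tail-none : ∀ f x {i m} → i ≤ m → (∀ k → i ≤ k → k < m → x ≤ f k) →
  countBelow x (segment f i (m ∸ i)) ≡ 0
countBelow-tail-none f x {m = m} i≤m above =
  trans (countBelow-tail f x i≤m ≤-refl above (λ k m≤k k<m → contradiction m≤k (<⇒≱ k<m))) (n∸n≡0 m)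

-- Avoiding a pattern of length three

sameOrder-length : ∀ σ c → sameOrder σ c ≡ true → length σ ≡ length c
sameOrder-length []       []       _  = refl
sameOrder-length (a ∷ σ) (b ∷ c) eq = cong suc (sameOrder-length σ c (proj₂ (∧-true⁻ eq)))

⊆-subseqs : ∀ xs {c} → c ∈ subseqs xs → ∀ {z} → z ∈ c → z ∈ xs
⊆-subseqs []       (here refl) ()
⊆-subseqs (x ∷ xs) c∈ z∈ with ∈-++⁻ (map (x ∷_) (subseqs xs)) c∈
... | inj₂ c∈′ = there (⊆-subseqs xs c∈′ z∈)
... | inj₁ xc∈ with ∈-map⁻ (x ∷_) xc∈ | z∈
... | c , c∈′ , refl | here refl = here refl
... | c , c∈′ , refl | there z∈′ = there (⊆-subseqs xs c∈′ z∈′)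

AllPairs-subseqs : ∀ {R : ℕ → ℕ → Set} xs {c} → c ∈ subseqs xs → AllPairs R xs → AllPairs R c
AllPairs-subseqs []       (here refl) [] = []
AllPairs-subseqs (x ∷ xs) c∈ (Rx ∷ Rxs) with ∈-++⁻ (map (x ∷_) (subseqs xs)) c∈
... | inj₂ c∈′ = AllPairs-subseqs xs c∈′ Rxs
... | inj₁ xc∈ with ∈-map⁻ (x ∷_) xc∈
... | c , c∈′ , refl = All.anti-mono (⊆-subseqs xs c∈′) Rx ∷ AllPairs-subseqs xs c∈′ Rxs

module _ (_⊏_ : ℕ → ℕ → Set) where

  Unsorted : ℕ → ℕ → ℕ → Set
  Unsorted x y z = ¬ x ⊏ y × ¬ y ⊏ z × ¬ x ⊏ z

  module _ (colour : ℕ → Bool) where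

    ColourSorted : List ℕ → Set
    ColourSorted = AllPairs (λ x y → colour x ≡ colour y → x ⊏ y)

    unsorted⇒¬colourSorted : ∀ x y z → Unsorted x y z → ¬ ColourSorted (x ∷ y ∷ z ∷ [])
    unsorted⇒¬colourSorted x y z (¬x⊏y , ¬y⊏z , ¬x⊏z) ((x⊏y ∷ x⊏z ∷ []) ∷ (y⊏z ∷ []) ∷ [] ∷ [])
      with colour x | colour y | colour z
    ... | true  | true  | _     = ¬x⊏y (x⊏y refl)
    ... | false | false | _     = ¬x⊏y (x⊏y refl)
    ... | _     | true  | true  = ¬y⊏z (y⊏z refl)
    ... | _     | false | false = ¬y⊏z (y⊏z refl)
    ... | true  | false | true  = ¬x⊏z (x⊏z refl)
    ... | false | true  | false = ¬x⊏z (x⊏z refl)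

    colourSorted-avoids : ∀ σ π → length σ ≡ 3 →
      (∀ x y z → sameOrder σ (x ∷ y ∷ z ∷ []) ≡ true → Unsorted x y z) →
      ColourSorted π → avoids σ π ≡ true
    colourSorted-avoids σ π |σ|≡3 unsorted sorted =
      cong not (any-false⁺ (sameOrder σ) (subseqs π)
                           (λ c∈ → no-occurrence _ (AllPairs-subseqs π c∈ sorted)))
      where
      no-occurrence : ∀ c → ColourSorted c → sameOrder σ c ≡ false
      no-occurrence c sorted-c with sameOrder σ c in occ
      ... | false = refl
      ... | true  = contradiction sorted-c (triple c (trans (sym (sameOrder-length σ c occ)) |σ|≡3) occ)
        where
        triple : ∀ c → length c ≡ 3 → sameOrder σ c ≡ true → ¬ ColourSorted c
        triple (x ∷ y ∷ z ∷ []) _ occ = unsorted⇒¬colourSorted x y z (unsorted x y z occ)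

-- Every other outcome of the six comparisons turns occ into a proof of false ≡ true.
occurrence-321-unsorted : ∀ x y z → sameOrder (3 ∷ 2 ∷ 1 ∷ []) (x ∷ y ∷ z ∷ []) ≡ true → Unsorted _<_ x y z
occurrence-321-unsorted x y z occ
  with x <ᵇ y | y <ᵇ x in y<ᵇx | x <ᵇ z | z <ᵇ x | y <ᵇ z | z <ᵇ y in z<ᵇy
occurrence-321-unsorted x y z refl | false | true | false | true | false | true =
  <-asym y<x , <-asym z<y , <-asym (<-trans z<y y<x)
  where
  y<x = <ᵇ⇒< y x (subst T (sym y<ᵇx) _)
  z<y = <ᵇ⇒< z y (subst T (sym z<ᵇy) _)

occurrence-123-unsorted : ∀ x y z → sameOrder (1 ∷ 2 ∷ 3 ∷ []) (x ∷ y ∷ z ∷ []) ≡ true → Unsorted _>_ x y z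
occurrence-123-unsorted x y z occ
  with x <ᵇ y in x<ᵇy | y <ᵇ x | x <ᵇ z | z <ᵇ x | y <ᵇ z in y<ᵇz | z <ᵇ y
occurrence-123-unsorted x y z refl | true | false | true | false | true | false =
  <-asym x<y , <-asym y<z , <-asym (<-trans x<y y<z)
  where
  x<y = <ᵇ⇒< x y (subst T (sym x<ᵇy) _)
  y<z = <ᵇ⇒< y z (subst T (sym y<ᵇz) _)

-- Ballot paths and Catalan words

module _ (m : ℕ) where

  -- Ballot m i j w: w is the rest of a Catalan word of semilength m once i zeros and j ones
  -- have been read.
  data Ballot : ℕ → ℕ → List ℕ → Set where
    done  : Ballot m m []
    step₀ : ∀ {i j w} → j ≤ i → i < m → Ballot (suc i) j w → Ballot i j (0 ∷ w)
    step₁ : ∀ {i j w} → j < i → Ballot i (suc j) w → Ballot i j (1 ∷ w)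

  Ballot-≤ : ∀ {i j w} → Ballot i j w → j ≤ i × i ≤ m
  Ballot-≤ done                = ≤-refl , ≤-refl
  Ballot-≤ (step₀ j≤i i<m _)   = j≤i , <⇒≤ i<m
  Ballot-≤ (step₁ j<i b)       = <⇒≤ j<i , proj₂ (Ballot-≤ b)

  private
    count₀ : ∀ {i j w} → Ballot i j w → count 0 w + i ≡ m
    count₀ done                        = refl
    count₀ {i} (step₀ {w = w} _ _ b)   = trans (sym (+-suc (count 0 w) i)) (count₀ b)
    count₀ (step₁ _ b)                 = count₀ b

    count₁ : ∀ {i j w} → Ballot i j w → count 1 w + j ≡ m
    count₁ done                        = refl
    count₁ (step₀ _ _ b)               = count₁ b
    count₁ {j = j} (step₁ {w = w} _ b) = trans (sym (+-suc (count 1 w) j)) (count₁ b)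

    ballot-true : ∀ {i j w} → Ballot i j w → ballot (i ∸ j) w ≡ true
    ballot-true done                      = refl
    ballot-true (step₀ {w = w} j≤i _ b) = subst (λ d → ballot d w ≡ true) (+-∸-assoc 1 j≤i) (ballot-true b)
    ballot-true (step₁ j<i b) rewrite ∸≡suc[∸suc] j<i = ballot-true b

    length-Ballot : ∀ {i j w} → Ballot i j w → length w + i + j ≡ m + m
    length-Ballot done = refl
    length-Ballot {i} {j} (step₀ {w = w} _ _ b) =
      trans (cong (_+ j) (sym (+-suc (length w) i))) (length-Ballot b)
    length-Ballot {i} {j} (step₁ {w = w} _ b)   = trans (sym (+-suc (length w + i) j)) (length-Ballot b)

    ∈-words01 : ∀ {i j w} → Ballot i j w → w ∈ words01 (length w)
    ∈-words01 done          = here refl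
    ∈-words01 (step₀ _ _ b) = ∈-++⁺ˡ (∈-map⁺ (0 ∷_) (∈-words01 b))
    ∈-words01 (step₁ {w = w} _ b) =
      ∈-++⁺ʳ (map (0 ∷_) (words01 (length w))) (∈-map⁺ (1 ∷_) (∈-words01 b))

    ≡⇒≡ᵇ-true : ∀ {a b} → a ≡ b → (a ≡ᵇ b) ≡ true
    ≡⇒≡ᵇ-true {a} refl = Equivalence.to T-≡ (≡⇒≡ᵇ a a refl)

    ≡ᵇ-true⇒≡ : ∀ {a b} → (a ≡ᵇ b) ≡ true → a ≡ b
    ≡ᵇ-true⇒≡ {a} {b} eq = ≡ᵇ⇒≡ a b (Equivalence.from T-≡ eq)

  Ballot⇒∈CW : ∀ {w} → Ballot 0 0 w → w ∈ CW m
  Ballot⇒∈CW {w} b =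
    ∈-filter⁺ (λ w → isCatalan m w ≟ᵇ true) (subst (λ k → w ∈ words01 k) |w|≡2m (∈-words01 b))
    (cong₂ _∧_ (≡⇒≡ᵇ-true (trans (sym (+-identityʳ _)) (count₀ b)))
      (cong₂ _∧_ (≡⇒≡ᵇ-true (trans (sym (+-identityʳ _)) (count₁ b))) (ballot-true b)))
    where
    |w|≡2m : length w ≡ 2 * m
    |w|≡2m = begin
      length w          ≡⟨ sym (trans (+-identityʳ _) (+-identityʳ _)) ⟩
      length w + 0 + 0  ≡⟨ length-Ballot b ⟩
      m + m             ≡⟨ cong (_+_ m) (sym (+-identityʳ m)) ⟩
      2 * m             ∎
      where open ≡-Reasoning

  private
    Binary : List ℕ → Set
    Binary = All (λ x → x ≡ 0 ⊎ x ≡ 1)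

    words01-binary : ∀ k {w} → w ∈ words01 k → Binary w
    words01-binary zero    (here refl) = []
    words01-binary (suc k) w∈ with ∈-++⁻ (map (0 ∷_) (words01 k)) w∈
    ... | inj₁ w∈₀ with ∈-map⁻ (0 ∷_) w∈₀
    ...   | _ , w′∈ , refl = inj₁ refl ∷ words01-binary k w′∈
    words01-binary (suc k) w∈ | inj₂ w∈₁ with ∈-map⁻ (1 ∷_) w∈₁
    ...   | _ , w′∈ , refl = inj₂ refl ∷ words01-binary k w′∈

    toBallot : ∀ w i j → Binary w → j ≤ i → count 0 w + i ≡ m → count 1 w + j ≡ m →
               ballot (i ∸ j) w ≡ true → Ballot i j w
    toBallot []      i j _ _ refl refl _ = done
    toBallot (.0 ∷ w) i j (inj₁ refl ∷ bin) j≤i c₀ c₁ bal =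
      step₀ j≤i (subst (i <_) c₀ (s≤s (m≤n+m i (count 0 w))))
        (toBallot w (suc i) j bin (m≤n⇒m≤1+n j≤i) (trans (+-suc (count 0 w) i) c₀) c₁
          (subst (λ d → ballot d w ≡ true) (sym (+-∸-assoc 1 j≤i)) bal))
    toBallot (.1 ∷ w) i j (inj₂ refl ∷ bin) j≤i c₀ c₁ bal with j <? i
    ... | yes j<i = step₁ j<i (toBallot w i (suc j) bin j<i c₀ (trans (+-suc (count 1 w) j) c₁)
                      (subst (λ d → ballot d (1 ∷ w) ≡ true) (∸≡suc[∸suc] j<i) bal))
    ... | no  j≮i rewrite ≤-antisym j≤i (≮⇒≥ j≮i) | n∸n≡0 i with () ← bal

  ∈CW⇒Ballot : ∀ {w} → w ∈ CW m → Ballot 0 0 w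
  ∈CW⇒Ballot {w} w∈ with ∈-filter⁻ (λ w → isCatalan m w ≟ᵇ true) w∈
  ... | w∈words , cat with ∧-true⁻ cat
  ...   | c₀ , rest with ∧-true⁻ {count 1 w ≡ᵇ m} rest
  ...     | c₁ , bal = toBallot w 0 0 (words01-binary (2 * m) w∈words) z≤n
                         (trans (+-identityʳ _) (≡ᵇ-true⇒≡ c₀))
                         (trans (+-identityʳ _) (≡ᵇ-true⇒≡ c₁)) bal

  zeros-Ballot : ∀ {i j w} → Ballot i j w → countBelow 1 w ≡ m ∸ i
  zeros-Ballot done               = sym (n∸n≡0 m)
  zeros-Ballot (step₀ _ i<m b)    = trans (cong suc (zeros-Ballot b)) (sym (∸≡suc[∸suc] i<m))
  zeros-Ballot (step₁ _ b)        = zeros-Ballot b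

words01-unique : ∀ k → Unique (words01 k)
words01-unique zero    = [] ∷ []
words01-unique (suc k) =
  Unique.++⁺ (Unique.map⁺ ∷-injectiveʳ (words01-unique k)) (Unique.map⁺ ∷-injectiveʳ (words01-unique k))
             heads-differ
  where
  heads-differ : ∀ {v} → ¬ (v ∈ map (0 ∷_) (words01 k) × v ∈ map (1 ∷_) (words01 k))
  heads-differ (v∈₀ , v∈₁) with ∈-map⁻ (0 ∷_) v∈₀ | ∈-map⁻ (1 ∷_) v∈₁
  ... | _ , _ , refl | _ , _ , ()

CW-unique : ∀ m → Unique (CW m)
CW-unique m = Unique.filter⁺ _ (words01-unique (2 * m))

-- Posets that are two interleaved chains

record TwoChains (_≼_ : ℕ → ℕ → Bool) (m : ℕ) : Set where
  field
    lower upper : ℕ → ℕ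
    lower≼lower : ∀ {k k′} → k < m → k′ < m → lower k ≼ lower k′ ≡ (k ≤ᵇ k′)
    upper≼upper : ∀ {k k′} → k < m → k′ < m → upper k ≼ upper k′ ≡ (k ≤ᵇ k′)
    lower≼upper : ∀ {k k′} → k < m → k′ < m → lower k ≼ upper k′ ≡ (k ≤ᵇ k′)
    upper⋠lower : ∀ {k k′} → k < m → k′ < m → upper k ≼ lower k′ ≡ false

module TwoChainMerge {_≼_ : ℕ → ℕ → Bool} {m : ℕ} (C : TwoChains _≼_ m) where

  open TwoChains C

  private
    ≤ᵇ-refl : ∀ k → (k ≤ᵇ k) ≡ true
    ≤ᵇ-refl k = ≤⇒≤ᵇ-true {k} ≤-refl

    -- Injectivity need not be assumed: equal elements would be ≼-related to the same elements.
    lower≡⇒≤ : ∀ {k k′} → k < m → k′ < m → lower k ≡ lower k′ → k ≤ k′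
    lower≡⇒≤ {k} {k′} k<m k′<m eq = ≤ᵇ-true⇒≤ (begin
      k ≤ᵇ k′               ≡⟨ lower≼lower k<m k′<m ⟨
      lower k ≼ lower k′    ≡⟨ cong (_≼ lower k′) eq ⟩
      lower k′ ≼ lower k′   ≡⟨ lower≼lower k′<m k′<m ⟩
      k′ ≤ᵇ k′              ≡⟨ ≤ᵇ-refl k′ ⟩
      true                  ∎)
      where open ≡-Reasoning

    upper≡⇒≤ : ∀ {k k′} → k < m → k′ < m → upper k ≡ upper k′ → k ≤ k′
    upper≡⇒≤ {k} {k′} k<m k′<m eq = ≤ᵇ-true⇒≤ (begin
      k ≤ᵇ k′               ≡⟨ upper≼upper k<m k′<m ⟨
      upper k ≼ upper k′    ≡⟨ cong (_≼ upper k′) eq ⟩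
      upper k′ ≼ upper k′   ≡⟨ upper≼upper k′<m k′<m ⟩
      k′ ≤ᵇ k′              ≡⟨ ≤ᵇ-refl k′ ⟩
      true                  ∎)
      where open ≡-Reasoning

  lower-injective : ∀ {k k′} → k < m → k′ < m → lower k ≡ lower k′ → k ≡ k′
  lower-injective k<m k′<m eq = ≤-antisym (lower≡⇒≤ k<m k′<m eq) (lower≡⇒≤ k′<m k<m (sym eq))

  upper-injective : ∀ {k k′} → k < m → k′ < m → upper k ≡ upper k′ → k ≡ k′
  upper-injective k<m k′<m eq = ≤-antisym (upper≡⇒≤ k<m k′<m eq) (upper≡⇒≤ k′<m k<m (sym eq))

  lower≢upper : ∀ {k k′} → k < m → k′ < m → lower k ≢ upper k′
  lower≢upper {k} {k′} k<m k′<m eq = contradiction (trans (sym (upper⋠lower k′<m k<m)) upper≼lower) λ ()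
    where
    open ≡-Reasoning
    upper≼lower : upper k′ ≼ lower k ≡ true
    upper≼lower = begin
      upper k′ ≼ lower k    ≡⟨ cong (upper k′ ≼_) eq ⟩
      upper k′ ≼ upper k′   ≡⟨ upper≼upper k′<m k′<m ⟩
      k′ ≤ᵇ k′              ≡⟨ ≤ᵇ-refl k′ ⟩
      true                  ∎

  merge : ℕ → ℕ → List ℕ → List ℕ
  merge i j []          = []
  merge i j (zero ∷ w)  = lower i ∷ merge (suc i) j w
  merge i j (suc _ ∷ w) = upper j ∷ merge i (suc j) w

  rest : ℕ → ℕ → List ℕ
  rest i j = segment lower i (m ∸ i) ++ segment upper j (m ∸ j)

  rest-lower : ∀ {i} j → i < m → rest i j ≡ lower i ∷ rest (suc i) j
  rest-lower j i<m rewrite ∸≡suc[∸suc] i<m = refl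

  rest-upper : ∀ i {j} → j < m → rest i j ↭ upper j ∷ rest i (suc j)
  rest-upper i j<m rewrite ∸≡suc[∸suc] j<m = ↭-shift _ (segment lower i (m ∸ i)) _

  merge-↭-rest : ∀ {i j w} → Ballot m i j w → merge i j w ↭ rest i j
  merge-↭-rest done rewrite n∸n≡0 m = ↭-refl
  merge-↭-rest {j = j} (step₀ _ i<m b) =
    ↭-trans (prep _ (merge-↭-rest b)) (↭-reflexive (sym (rest-lower j i<m)))
  merge-↭-rest {i} (step₁ j<i b) =
    ↭-trans (prep _ (merge-↭-rest b)) (↭-sym (rest-upper i (<-≤-trans j<i (proj₂ (Ballot-≤ m b)))))

  LowerFrom UpperFrom : ℕ → ℕ → Set
  LowerFrom i x = ∃ λ k → i ≤ k × k < m × x ≡ lower k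
  UpperFrom j x = ∃ λ k → j ≤ k × k < m × x ≡ upper k

  ∈-rest⁻ : ∀ {i j x} → i ≤ m → j ≤ m → x ∈ rest i j → LowerFrom i x ⊎ UpperFrom j x
  ∈-rest⁻ {i} {j} i≤m j≤m x∈ with ∈-++⁻ (segment lower i (m ∸ i)) x∈
  ... | inj₁ x∈ˡ with ∈-segment⁻ lower i (m ∸ i) x∈ˡ
  ...   | k , i≤k , k<m , x≡ = inj₁ (k , i≤k , subst (k <_) (m+[n∸m]≡n i≤m) k<m , x≡)
  ∈-rest⁻ {i} {j} i≤m j≤m x∈ | inj₂ x∈ᵘ with ∈-segment⁻ upper j (m ∸ j) x∈ᵘ
  ...   | k , j≤k , k<m , x≡ = inj₂ (k , j≤k , subst (k <_) (m+[n∸m]≡n j≤m) k<m , x≡)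

  ∈-merge⁻ : ∀ {i j w x} → Ballot m i j w → x ∈ merge i j w → LowerFrom i x ⊎ UpperFrom j x
  ∈-merge⁻ b x∈ with Ballot-≤ m b
  ... | j≤i , i≤m = ∈-rest⁻ i≤m (≤-trans j≤i i≤m) (∈-resp-↭ (merge-↭-rest b) x∈)

  ⋠-lower : ∀ {i j y} → i < m → LowerFrom (suc i) y ⊎ UpperFrom j y → y ≼ lower i ≡ false
  ⋠-lower i<m (inj₁ (k , i<k , k<m , refl)) = trans (lower≼lower k<m i<m) (>⇒≤ᵇ-false i<k)
  ⋠-lower i<m (inj₂ (k , _   , k<m , refl)) = upper⋠lower k<m i<m

  ⋠-upper : ∀ {i j y} → j < i → j < m → LowerFrom i y ⊎ UpperFrom (suc j) y → y ≼ upper j ≡ false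
  ⋠-upper j<i j<m (inj₁ (k , i≤k , k<m , refl)) =
    trans (lower≼upper k<m j<m) (>⇒≤ᵇ-false (<-≤-trans j<i i≤k))
  ⋠-upper j<i j<m (inj₂ (k , j<k , k<m , refl)) = trans (upper≼upper k<m j<m) (>⇒≤ᵇ-false j<k)

  merge-isLinExt : ∀ {i j w} → Ballot m i j w → isLinExt _≼_ (merge i j w) ≡ true
  merge-isLinExt done = refl
  merge-isLinExt (step₀ _ i<m b) =
    cong₂ _∧_ (all-true⁺ _ _ (cong not ∘ ⋠-lower i<m ∘ ∈-merge⁻ b)) (merge-isLinExt b)
  merge-isLinExt (step₁ j<i b) =
    cong₂ _∧_ (all-true⁺ _ _ (cong not ∘ ⋠-upper j<i j<m ∘ ∈-merge⁻ b)) (merge-isLinExt b)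
    where j<m = <-≤-trans j<i (proj₂ (Ballot-≤ m b))

  private
    ⋠-head : ∀ {x π ρ y} → isLinExt _≼_ (x ∷ π) ≡ true → x ∷ π ↭ ρ → y ∈ ρ → y ≢ x →
             y ≼ x ≡ false
    ⋠-head {x} {π} lin π↭ y∈ y≢x with ∈-resp-↭ (↭-sym π↭) y∈
    ... | here y≡x  = contradiction y≡x y≢x
    ... | there y∈π = trans (sym (not-involutive _))
                            (cong not (all-true⁻ (λ y → not (y ≼ x)) π (proj₁ (∧-true⁻ lin)) y∈π))

    ≼-by-index : ∀ {x y a b} → y ≼ x ≡ false → y ≼ x ≡ (a ≤ᵇ b) → ¬ a ≤ b
    ≼-by-index ⋠ ≼≡ a≤b with () ← trans (sym ⋠) (trans ≼≡ (≤⇒≤ᵇ-true a≤b))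

    lower∈rest : ∀ {i} j → i < m → lower i ∈ rest i j
    lower∈rest j i<m = subst (_ ∈_) (sym (rest-lower j i<m)) (here refl)

    upper∈rest : ∀ i {j} → j < m → upper j ∈ rest i j
    upper∈rest i j<m = ∈-resp-↭ (↭-sym (rest-upper i j<m)) (here refl)

    head-lower : ∀ {i j k π} → isLinExt _≼_ (lower k ∷ π) ≡ true → lower k ∷ π ↭ rest i j →
                 i ≤ k → k < m → k ≡ i
    head-lower {i} {j} {k} lin π↭ i≤k k<m with m≤n⇒m<n∨m≡n i≤k
    ... | inj₂ i≡k = sym i≡k
    ... | inj₁ i<k = contradiction (<⇒≤ i<k)
          (≼-by-index (⋠-head lin π↭ (lower∈rest j i<m) (<⇒≢ i<k ∘ lower-injective i<m k<m))
                      (lower≼lower i<m k<m))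
      where i<m = <-trans i<k k<m

    head-upper : ∀ {i j k π} → isLinExt _≼_ (upper k ∷ π) ≡ true → upper k ∷ π ↭ rest i j →
                 i ≤ m → j ≤ k → k < m → k ≡ j × j < i
    head-upper {i} {j} {k} lin π↭ i≤m j≤k k<m = k≡j , j<i
      where
      k≡j : k ≡ j
      k≡j with m≤n⇒m<n∨m≡n j≤k
      ... | inj₂ j≡k = sym j≡k
      ... | inj₁ j<k = contradiction (<⇒≤ j<k)
            (≼-by-index (⋠-head lin π↭ (upper∈rest i j<m) (<⇒≢ j<k ∘ upper-injective j<m k<m))
                        (upper≼upper j<m k<m))
        where j<m = <-trans j<k k<m
      j<i : j < i
      j<i with j <? i
      ... | yes j<i = j<i
      ... | no  j≮i = contradiction (≤-trans i≤j j≤k)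
            (≼-by-index (⋠-head lin π↭ (lower∈rest j i<m) (lower≢upper i<m k<m)) (lower≼upper i<m k<m))
        where
        i≤j = ≮⇒≥ j≮i
        i<m = ≤-<-trans (≤-trans i≤j j≤k) k<m

    rest-empty : ∀ {i j} → [] ↭ rest i j → m ∸ i ≡ 0 × m ∸ j ≡ 0
    rest-empty {i} {j} []↭ = m+n≡0⇒m≡0 (m ∸ i) |rest|≡0 , m+n≡0⇒n≡0 (m ∸ i) |rest|≡0
      where
      |rest|≡0 : (m ∸ i) + (m ∸ j) ≡ 0
      |rest|≡0 = begin
        (m ∸ i) + (m ∸ j)  ≡⟨ cong₂ _+_ (length-segment lower i (m ∸ i)) (length-segment upper j (m ∸ j)) ⟨
        length (segment lower i (m ∸ i)) + length (segment upper j (m ∸ j))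
                           ≡⟨ length-++ (segment lower i (m ∸ i)) ⟨
        length (rest i j)  ≡⟨ ↭-length []↭ ⟨
        0                  ∎
        where open ≡-Reasoning

  linExt⇒Ballot : ∀ π i j → j ≤ i → i ≤ m → π ↭ rest i j → isLinExt _≼_ π ≡ true →
                  ∃ λ w → Ballot m i j w × π ≡ merge i j w
  linExt⇒Ballot [] i j j≤i i≤m []↭ _
    with ≤-antisym i≤m (m∸n≡0⇒m≤n (proj₁ (rest-empty {i} {j} []↭)))
       | ≤-antisym (≤-trans j≤i i≤m) (m∸n≡0⇒m≤n (proj₂ (rest-empty {i} {j} []↭)))
  ... | refl | refl = [] , done , refl
  linExt⇒Ballot (x ∷ π) i j j≤i i≤m π↭ lin with ∈-rest⁻ i≤m (≤-trans j≤i i≤m) (∈-resp-↭ π↭ (here refl))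
  ... | inj₁ (k , i≤k , k<m , refl) with head-lower lin π↭ i≤k k<m
  ...   | refl with linExt⇒Ballot π (suc k) j (m≤n⇒m≤1+n j≤i) k<m
                      (drop-∷ (↭-trans π↭ (↭-reflexive (rest-lower j k<m)))) (proj₂ (∧-true⁻ lin))
  ...     | w , b , refl = 0 ∷ w , step₀ j≤i k<m b , refl
  linExt⇒Ballot (x ∷ π) i j j≤i i≤m π↭ lin | inj₂ (k , j≤k , k<m , refl)
    with head-upper lin π↭ i≤m j≤k k<m
  ...   | refl , k<i with linExt⇒Ballot π i (suc k) k<i i≤m
                           (drop-∷ (↭-trans π↭ (rest-upper i k<m))) (proj₂ (∧-true⁻ lin))
  ...     | w , b , refl = 1 ∷ w , step₁ k<i b , refl

  merge-injective : ∀ {i j w w′} → Ballot m i j w → Ballot m i j w′ → merge i j w ≡ merge i j w′ → w ≡ w′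
  merge-injective done done _ = refl
  merge-injective (step₀ _ _ b) (step₀ _ _ b′) eq = cong (0 ∷_) (merge-injective b b′ (proj₂ (∷-injective eq)))
  merge-injective (step₁ _ b) (step₁ _ b′) eq = cong (1 ∷_) (merge-injective b b′ (proj₂ (∷-injective eq)))
  merge-injective (step₀ _ i<m _) (step₁ j<i b′) eq =
    contradiction (proj₁ (∷-injective eq)) (lower≢upper i<m (<-≤-trans j<i (proj₂ (Ballot-≤ m b′))))
  merge-injective (step₁ j<i b) (step₀ _ i<m _) eq =
    contradiction (sym (proj₁ (∷-injective eq))) (lower≢upper i<m (<-≤-trans j<i (proj₂ (Ballot-≤ m b))))

  countBelow-merge : ∀ {i j w} x → Ballot m i j w →
    countBelow x (merge i j w) ≡
    countBelow x (segment lower i (m ∸ i)) + countBelow x (segment upper j (m ∸ j))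
  countBelow-merge {i} x b =
    trans (countBelow-↭ x (merge-↭-rest b)) (countBelow-++ x (segment lower i (m ∸ i)) _)

  module _ (_⊏_ : ℕ → ℕ → Set) (colour : ℕ → Bool)
           (colour-lower : ∀ {k} → k < m → colour (lower k) ≡ true)
           (colour-upper : ∀ {k} → k < m → colour (upper k) ≡ false)
           (lower-⊏ : ∀ {k k′} → k < k′ → k′ < m → lower k ⊏ lower k′)
           (upper-⊏ : ∀ {k k′} → k < k′ → k′ < m → upper k ⊏ upper k′) where

    merge-colourSorted : ∀ {i j w} → Ballot m i j w → ColourSorted _⊏_ colour (merge i j w)
    merge-colourSorted done = []
    merge-colourSorted {i} (step₀ _ i<m b) = All.tabulate (after-lower ∘ ∈-merge⁻ b) ∷ merge-colourSorted b
      where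
      after-lower : ∀ {y} → LowerFrom (suc i) y ⊎ UpperFrom _ y → colour (lower i) ≡ colour y → lower i ⊏ y
      after-lower (inj₁ (k , i<k , k<m , refl)) _  = lower-⊏ i<k k<m
      after-lower (inj₂ (k , _   , k<m , refl)) eq with () ←
        trans (sym (colour-lower i<m)) (trans eq (colour-upper k<m))
    merge-colourSorted {i} {j} (step₁ j<i b) = All.tabulate (after-upper ∘ ∈-merge⁻ b) ∷ merge-colourSorted b
      where
      j<m = <-≤-trans j<i (proj₂ (Ballot-≤ m b))
      after-upper : ∀ {y} → LowerFrom i y ⊎ UpperFrom (suc j) y → colour (upper j) ≡ colour y → upper j ⊏ y
      after-upper (inj₁ (k , _   , k<m , refl)) eq with () ←
        trans (sym (colour-lower k<m)) (trans (sym eq) (colour-upper j<m))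
      after-upper (inj₂ (k , j<k , k<m , refl)) _  = upper-⊏ j<k k<m

  module Enumeration (n : ℕ) (σ : List ℕ)
                     (elements : segment lower 0 m ++ segment upper 0 m ↭ range1 n)
                     (merge-avoids : ∀ {w} → Ballot m 0 0 w → avoids σ (merge 0 0 w) ≡ true) where

    Admissible : List ℕ → Bool
    Admissible π = isLinExt _≼_ π ∧ avoids σ π

    admissible : List (List ℕ)
    admissible = filter (λ π → Admissible π ≟ᵇ true) (perms (range1 n))

    admissible-↭-merges : admissible ↭ map (merge 0 0) (CW m)
    admissible-↭-merges =
      unique-⇔⇒↭ (Unique.filter⁺ _ (perms-unique _ (range1-unique n)))
                 (Unique-map⁺-on (merge 0 0)
                   (λ w∈ w′∈ → merge-injective (∈CW⇒Ballot m w∈) (∈CW⇒Ballot m w′∈)) (CW-unique m))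
                 (mk⇔ to from)
      where
      to : ∀ {π} → π ∈ admissible → π ∈ map (merge 0 0) (CW m)
      to π∈ with ∈-filter⁻ (λ π → Admissible π ≟ᵇ true) π∈
      ... | π∈perms , adm
        with linExt⇒Ballot _ 0 0 z≤n z≤n (↭-trans (∈-perms⇒↭ _ π∈perms) (↭-sym elements))
                           (proj₁ (∧-true⁻ adm))
      ...   | w , b , refl = ∈-map⁺ (merge 0 0) (Ballot⇒∈CW m b)
      from : ∀ {π} → π ∈ map (merge 0 0) (CW m) → π ∈ admissible
      from π∈ with ∈-map⁻ (merge 0 0) π∈
      ... | w , w∈ , refl = ∈-filter⁺ (λ π → Admissible π ≟ᵇ true)
              (↭⇒∈-perms _ (↭-trans (merge-↭-rest b) elements))
              (cong₂ _∧_ (merge-isLinExt b) (merge-avoids b))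
        where b = ∈CW⇒Ballot m w∈

    genfun-↭-merges : genfun n _≼_ σ ↭ map (λ w → + inv (merge 0 0 w)) (CW m)
    genfun-↭-merges =
      ↭-trans (map⁺ (λ π → + inv π) admissible-↭-merges) (↭-reflexive (sym (map-∘ (CW m))))

    genfun≈shift-Cq : ∀ c → (∀ {w} → Ballot m 0 0 w → inv (merge 0 0 w) ≡ c + inv w) →
                      genfun n _≼_ σ ≈P shift (+ c) (Cq m)
    genfun≈shift-Cq c inv-merge = ↭-trans genfun-↭-merges (↭-reflexive (begin
      map (λ w → + inv (merge 0 0 w)) (CW m)   ≡⟨ map-cong-local (All.tabulate λ w∈ →
                                                    trans (cong +_ (inv-merge (∈CW⇒Ballot m w∈))) (ℤ.pos-+ c _)) ⟩
      map (λ w → + c ℤ.+ + inv w) (CW m)       ≡⟨ map-∘ (CW m) ⟩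
      shift (+ c) (Cq m)                       ∎))
      where open ≡-Reasoning

    genfun≈shift-Ctq : ∀ c → (∀ {w} → Ballot m 0 0 w → inv (merge 0 0 w) + inv w ≡ c + binom2 m) →
                       genfun n _≼_ σ ≈P shift (+ c) (Ctq m)
    genfun≈shift-Ctq c inv-merge = ↭-trans genfun-↭-merges (↭-reflexive (begin
      map (λ w → + inv (merge 0 0 w)) (CW m)
        ≡⟨ map-cong-local (All.tabulate λ w∈ → sum⇒difference (inv-merge (∈CW⇒Ballot m w∈))) ⟩
      map (λ w → + c ℤ.+ (+ binom2 m ℤ.+ ℤ.- + inv w)) (CW m)
        ≡⟨ map-∘ (CW m) ⟩
      map (λ e → + c ℤ.+ e) (map (λ w → + binom2 m ℤ.+ ℤ.- + inv w) (CW m))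
        ≡⟨ cong (map (λ e → + c ℤ.+ e)) (map-∘ (CW m)) ⟩
      map (λ e → + c ℤ.+ e) (map (λ e → + binom2 m ℤ.+ e) (map (λ w → ℤ.- + inv w) (CW m)))
        ≡⟨ cong (map (λ e → + c ℤ.+ e) ∘ map (λ e → + binom2 m ℤ.+ e)) (map-∘ (CW m)) ⟩
      shift (+ c) (Ctq m)
        ∎))
      where
      open ≡-Reasoning
      sum⇒difference : ∀ {p q a b} → p + q ≡ a + b → + p ≡ + a ℤ.+ (+ b ℤ.+ ℤ.- + q)
      sum⇒difference {p} {q} {a} {b} eq = begin
        + p                          ≡⟨ add-sub (+ p) (+ q) ⟨
        (+ p ℤ.+ + q) ℤ.+ ℤ.- + q    ≡⟨ cong (λ e → e ℤ.+ ℤ.- + q) (trans (sym (ℤ.pos-+ p q))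
                                                                     (trans (cong +_ eq) (ℤ.pos-+ a b))) ⟩
        (+ a ℤ.+ + b) ℤ.+ ℤ.- + q    ≡⟨ ℤ.+-assoc (+ a) (+ b) (ℤ.- + q) ⟩
        + a ℤ.+ (+ b ℤ.+ ℤ.- + q)    ∎
        where
        add-sub : ∀ x y → (x ℤ.+ y) ℤ.+ ℤ.- y ≡ x
        add-sub x y =
          trans (ℤ.+-assoc x y (ℤ.- y)) (trans (cong (ℤ._+_ x) (ℤ.+-inverseʳ y)) (ℤ.+-identityʳ x))

choose₂ : ℕ → ℕ
choose₂ zero    = 0
choose₂ (suc n) = n + choose₂ n

choose₂*2 : ∀ n → choose₂ n * 2 ≡ n * (n ∸ 1)
choose₂*2 zero          = refl
choose₂*2 (suc zero)    = refl
choose₂*2 (suc (suc n)) = begin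
  (suc n + choose₂ (suc n)) * 2      ≡⟨ *-distribʳ-+ 2 (suc n) (choose₂ (suc n)) ⟩
  suc n * 2 + choose₂ (suc n) * 2    ≡⟨ cong (_+_ (suc n * 2)) (choose₂*2 (suc n)) ⟩
  suc n * 2 + suc n * n              ≡⟨ expand n ⟩
  suc (suc n) * suc n                ∎
  where
  open ≡-Reasoning
  expand : ∀ n → suc n * 2 + suc n * n ≡ suc (suc n) * suc n
  expand = solve-∀

binom2≡choose₂ : ∀ n → binom2 n ≡ choose₂ n
binom2≡choose₂ n = trans (cong (_/ 2) (sym (choose₂*2 n))) (m*n/n≡m (choose₂ n) 2)

square≡n+choose₂*2 : ∀ n → n * n ≡ n + choose₂ n * 2
square≡n+choose₂*2 zero    = refl
square≡n+choose₂*2 (suc n) = trans (*-suc (suc n) n) (cong (_+_ (suc n)) (sym (choose₂*2 (suc n))))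

pentagonal≡square+choose₂ : ∀ n → (n * (3 * n ∸ 1)) / 2 ≡ n * n + choose₂ n
pentagonal≡square+choose₂ n = trans (cong (_/ 2) (times-two n)) (m*n/n≡m (n * n + choose₂ n) 2)
  where
  times-two : ∀ n → n * (3 * n ∸ 1) ≡ (n * n + choose₂ n) * 2
  times-two zero    = refl
  times-two (suc n) = begin
    suc n * (n + suc (n + suc (n + 0)))        ≡⟨ expand n ⟩
    suc n * suc n * 2 + suc n * n              ≡⟨ cong (_+_ (suc n * suc n * 2)) (sym (choose₂*2 (suc n))) ⟩
    suc n * suc n * 2 + choose₂ (suc n) * 2    ≡⟨ *-distribʳ-+ 2 (suc n * suc n) (choose₂ (suc n)) ⟨
    (suc n * suc n + choose₂ (suc n)) * 2      ∎
    where
    open ≡-Reasoning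
    expand : ∀ n → suc n * (n + suc (n + suc (n + 0))) ≡ suc n * suc n * 2 + suc n * n
    expand = solve-∀

-- The element (j − 1)t + r of [st] in the 0-based coordinates q = j − 1 and r − 1 that blk and pos decode.
cell : ℕ → ℕ → ℕ → ℕ
cell t q r = suc (q * t + r)

blk-cell : ∀ {t} q {r} → r < t → blk t (cell t q r) ≡ q
blk-cell {suc t} q {r} r<t = begin
  (q * suc t + r) / suc t           ≡⟨ +-distrib-/-∣ˡ r (n∣m*n q) ⟩
  q * suc t / suc t + r / suc t     ≡⟨ cong₂ _+_ (m*n/n≡m q (suc t)) (m<n⇒m/n≡0 r<t) ⟩
  q + 0                             ≡⟨ +-identityʳ q ⟩
  q                                 ∎
  where open ≡-Reasoning

pos-cell : ∀ {t} q {r} → r < t → pos t (cell t q r) ≡ r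
pos-cell {suc t} q r<t = trans (%-remove-+ˡ _ (n∣m*n q)) (m<n⇒m%n≡m r<t)

EN≼-cell : ∀ {t} q q′ {r r′} → r < t → r′ < t →
           EN≼ t (cell t q r) (cell t q′ r′) ≡ (q′ ≤ᵇ q) ∧ (r ≤ᵇ r′)
EN≼-cell q q′ r<t r′<t
  rewrite blk-cell q r<t | blk-cell q′ r′<t | pos-cell q r<t | pos-cell q′ r′<t = refl

NE≼-cell : ∀ {t} q q′ {r r′} → r < t → r′ < t →
           NE≼ t (cell t q r) (cell t q′ r′) ≡ (q′ ≤ᵇ q) ∧ (r′ ≤ᵇ r)
NE≼-cell q q′ r<t r′<t
  rewrite blk-cell q r<t | blk-cell q′ r′<t | pos-cell q r<t | pos-cell q′ r′<t = refl

cell-<ʳ : ∀ {t} q {r r′} → r < r′ → cell t q r < cell t q r′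
cell-<ʳ {t} q r<r′ = s≤s (+-monoʳ-< (q * t) r<r′)

cell-<ˡ : ∀ {t q q′ r} r′ → r < t → q < q′ → cell t q r < cell t q′ r′
cell-<ˡ {t} {q} {q′} {r} r′ r<t q<q′ = s≤s (begin-strict
  q * t + r     <⟨ +-monoʳ-< (q * t) r<t ⟩
  q * t + t     ≡⟨ +-comm (q * t) t ⟩
  suc q * t     ≤⟨ *-monoˡ-≤ t q<q′ ⟩
  q′ * t        ≤⟨ m≤m+n (q′ * t) r′ ⟩
  q′ * t + r′   ∎)
  where open ≤-Reasoning

cell-≤-< : ∀ {t q q′ r r′} → r < t → q ≤ q′ → r < r′ → cell t q r < cell t q′ r′
cell-≤-< {t} {q} {r′ = r′} r<t q≤q′ r<r′ with m≤n⇒m<n∨m≡n q≤q′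
... | inj₁ q<q′ = cell-<ˡ r′ r<t q<q′
... | inj₂ refl = cell-<ʳ q r<r′

mirror : ℕ → ℕ → ℕ
mirror m k = m ∸ suc k

mirror-< : ∀ {m k} → k < m → mirror m k < m
mirror-< {suc m} {k} _ = s≤s (m∸n≤m m k)

mirror-antitone : ∀ {m k k′} → k ≤ k′ → mirror m k′ ≤ mirror m k
mirror-antitone {m} k≤k′ = ∸-monoʳ-≤ m (s≤s k≤k′)

mirror-strictlyAntitone : ∀ {m k k′} → k < k′ → k′ < m → mirror m k′ < mirror m k
mirror-strictlyAntitone k<k′ k′<m = ∸-monoʳ-< (s≤s k<k′) k′<m

mirror-≤ᵇ : ∀ {m k k′} → k < m → (mirror m k′ ≤ᵇ mirror m k) ≡ (k ≤ᵇ k′)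
mirror-≤ᵇ {m} {k} {k′} k<m with k ≤? k′
... | yes k≤k′ = trans (≤⇒≤ᵇ-true (mirror-antitone {m} k≤k′)) (sym (≤⇒≤ᵇ-true k≤k′))
... | no  k≰k′ =
  trans (>⇒≤ᵇ-false (mirror-strictlyAntitone (≰⇒> k≰k′) k<m)) (sym (>⇒≤ᵇ-false (≰⇒> k≰k′)))

range1-block : ∀ t q → range1 (suc q * t) ≡ range1 (q * t) ++ segment (cell t q) 0 t
range1-block t q = begin
  range1 (t + q * t)                               ≡⟨ cong range1 (+-comm t (q * t)) ⟩
  range1 (q * t + t)                               ≡⟨ range1≡segment (q * t + t) ⟩
  segment suc 0 (q * t + t)                        ≡⟨ segment-++ suc 0 (q * t) t ⟩
  segment suc 0 (q * t) ++ segment suc (q * t) t   ≡⟨ cong₂ _++_ (sym (range1≡segment (q * t))) block ⟩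
  range1 (q * t) ++ segment (cell t q) 0 t         ∎
  where
  open ≡-Reasoning
  block : segment suc (q * t) t ≡ segment (cell t q) 0 t
  block = trans (cong (λ x → segment suc x t) (sym (+-identityʳ (q * t)))) (segment-+ suc (q * t) 0 t)

segment-mirror : ∀ f m → segment (f ∘ mirror m) 0 m ≡ reverse (segment f 0 m)
segment-mirror f zero    = refl
segment-mirror f (suc m) = begin
  f m ∷ segment (f ∘ mirror (suc m)) 1 m     ≡⟨ cong (f m ∷_) (trans (segment-shift (f ∘ mirror (suc m)) 0 m)
                                                                (segment-mirror f m)) ⟩
  f m ∷ reverse (segment f 0 m)              ≡⟨ reverse-++ (segment f 0 m) (f m ∷ []) ⟨
  reverse (segment f 0 m ++ segment f m 1)   ≡⟨ cong reverse (segment-++ f 0 m 1) ⟨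
  reverse (segment f 0 (m + 1))              ≡⟨ cong (reverse ∘ segment f 0) (+-comm m 1) ⟩
  reverse (segment f 0 (suc m))              ∎
  where open ≡-Reasoning

rows-↭-range1 : ∀ t → segment (cell t 1) 0 t ++ segment (cell t 0) 0 t ↭ range1 (2 * t)
rows-↭-range1 t = ↭-trans (++-comm (segment (cell t 1) 0 t) _)
  (↭-reflexive (sym (trans (range1-block t 1) (cong (_++ segment (cell t 1) 0 t) (range1-block t 0)))))

columns-↭-range1 : ∀ s → segment (λ k → cell 2 (mirror s k) 0) 0 s ++ segment (λ k → cell 2 (mirror s k) 1) 0 s
                         ↭ range1 (s * 2)
columns-↭-range1 zero    = ↭-refl
columns-↭-range1 (suc s) = begin
  (cell 2 s 0 ∷ segment (odd (suc s)) 1 s) ++ (cell 2 s 1 ∷ segment (even (suc s)) 1 s)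
    ≡⟨ cong₂ (λ xs ys → (cell 2 s 0 ∷ xs) ++ (cell 2 s 1 ∷ ys))
             (segment-shift (odd (suc s)) 0 s) (segment-shift (even (suc s)) 0 s) ⟩
  cell 2 s 0 ∷ (segment (odd s) 0 s ++ cell 2 s 1 ∷ segment (even s) 0 s)
    ↭⟨ prep (cell 2 s 0) (↭-shift (cell 2 s 1) (segment (odd s) 0 s) _) ⟩
  (cell 2 s 0 ∷ cell 2 s 1 ∷ []) ++ (segment (odd s) 0 s ++ segment (even s) 0 s)
    ↭⟨ ++-comm (cell 2 s 0 ∷ cell 2 s 1 ∷ []) _ ⟩
  (segment (odd s) 0 s ++ segment (even s) 0 s) ++ segment (cell 2 s) 0 2
    ↭⟨ ++⁺ʳ _ (columns-↭-range1 s) ⟩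
  range1 (s * 2) ++ segment (cell 2 s) 0 2
    ≡⟨ range1-block 2 s ⟨
  range1 (suc s * 2) ∎
  where
  open PermutationReasoning
  odd even : ℕ → ℕ → ℕ
  odd  s k = cell 2 (mirror s k) 0
  even s k = cell 2 (mirror s k) 1

-- The four posets

module EN-2×t (t : ℕ) where

  lower upper : ℕ → ℕ
  lower = cell t 1
  upper = cell t 0

  chains : TwoChains (EN≼ t) t
  chains = record
    { lower = lower ; upper = upper
    ; lower≼lower = EN≼-cell 1 1 ; upper≼upper = EN≼-cell 0 0
    ; lower≼upper = EN≼-cell 1 0 ; upper⋠lower = EN≼-cell 0 1 }

  open TwoChainMerge chains

  lower-increasing : ∀ {k k′} → k < k′ → lower k < lower k′
  lower-increasing = cell-<ʳ {t} 1

  upper-increasing : ∀ {k k′} → k < k′ → upper k < upper k′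
  upper-increasing = cell-<ʳ {t} 0

  upper<lower : ∀ {k} k′ → k < t → upper k < lower k′
  upper<lower k′ k<t = cell-<ˡ {t} {0} {1} k′ k<t ≤-refl

  elements : segment lower 0 t ++ segment upper 0 t ↭ range1 (2 * t)
  elements = rows-↭-range1 t

  merge-avoids-321 : ∀ {w} → Ballot t 0 0 w → avoids (3 ∷ 2 ∷ 1 ∷ []) (merge 0 0 w) ≡ true
  merge-avoids-321 b = colourSorted-avoids _<_ colour _ _ refl occurrence-321-unsorted
    (merge-colourSorted _<_ colour (λ k<t → cong (_≡ᵇ 1) (blk-cell 1 k<t))
                                   (λ k<t → cong (_≡ᵇ 1) (blk-cell 0 k<t))
                        (λ k<k′ _ → lower-increasing k<k′) (λ k<k′ _ → upper-increasing k<k′) b)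
    where
    colour = λ x → blk t x ≡ᵇ 1

  -- Each remaining lower/upper pair is an inversion of exactly one of merge i j w and w.
  inversions : ∀ {i j w} → Ballot t i j w → inv (merge i j w) + inv w ≡ (t ∸ i) * (t ∸ j)
  inversions done rewrite n∸n≡0 t = refl
  inversions {i} {j} (step₀ {w = w} j≤i i<t b) = begin
    countBelow (lower i) (merge (suc i) j w) + inv (merge (suc i) j w) + (countBelow 0 w + inv w)
      ≡⟨ cong₂ (λ c z → c + inv (merge (suc i) j w) + (z + inv w)) below-lower (countBelow-zero w) ⟩
    (t ∸ j) + inv (merge (suc i) j w) + inv w    ≡⟨ +-assoc (t ∸ j) _ _ ⟩
    (t ∸ j) + (inv (merge (suc i) j w) + inv w)  ≡⟨ cong (_+_ (t ∸ j)) (inversions b) ⟩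
    (t ∸ j) + (t ∸ suc i) * (t ∸ j)              ≡⟨ cong (_* (t ∸ j)) (∸≡suc[∸suc] i<t) ⟨
    (t ∸ i) * (t ∸ j)                            ∎
    where
    open ≡-Reasoning
    below-lower : countBelow (lower i) (merge (suc i) j w) ≡ t ∸ j
    below-lower = trans (countBelow-merge (lower i) b) (cong₂ _+_
      (countBelow-tail-none lower (lower i) i<t (λ k i<k _ → <⇒≤ (lower-increasing i<k)))
      (countBelow-tail-all upper (lower i) (≤-trans j≤i (<⇒≤ i<t)) (λ k _ k<t → upper<lower i k<t)))
  inversions {i} {j} (step₁ {w = w} j<i b) = begin
    countBelow (upper j) (merge i (suc j) w) + inv (merge i (suc j) w) + (countBelow 1 w + inv w)
      ≡⟨ cong₂ (λ c z → c + inv (merge i (suc j) w) + (z + inv w)) below-upper (zeros-Ballot t b) ⟩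
    inv (merge i (suc j) w) + ((t ∸ i) + inv w)  ≡⟨ x∙yz≈y∙xz _ (t ∸ i) (inv w) ⟩
    (t ∸ i) + (inv (merge i (suc j) w) + inv w)  ≡⟨ cong (_+_ (t ∸ i)) (inversions b) ⟩
    (t ∸ i) + (t ∸ i) * (t ∸ suc j)              ≡⟨ *-suc (t ∸ i) (t ∸ suc j) ⟨
    (t ∸ i) * suc (t ∸ suc j)                    ≡⟨ cong (_*_ (t ∸ i)) (∸≡suc[∸suc] j<t) ⟨
    (t ∸ i) * (t ∸ j)                            ∎
    where
    open ≡-Reasoning
    i≤t = proj₂ (Ballot-≤ t b)
    j<t = <-≤-trans j<i i≤t
    below-upper : countBelow (upper j) (merge i (suc j) w) ≡ 0
    below-upper = trans (countBelow-merge (upper j) b) (cong₂ _+_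
      (countBelow-tail-none lower (upper j) i≤t (λ k _ _ → <⇒≤ (upper<lower k j<t)))
      (countBelow-tail-none upper (upper j) j<t (λ k j<k _ → <⇒≤ (upper-increasing j<k))))

  generating-function : EN 2 t (3 ∷ 2 ∷ 1 ∷ []) ≈P shift (+ binom2 (t + 1)) (Ctq t)
  generating-function = genfun≈shift-Ctq (binom2 (t + 1)) (λ b → trans (inversions b) square≡)
    where
    open Enumeration (2 * t) (3 ∷ 2 ∷ 1 ∷ []) elements merge-avoids-321
    open ≡-Reasoning
    square≡ : t * t ≡ binom2 (t + 1) + binom2 t
    square≡ = begin
      t * t                                ≡⟨ square≡n+choose₂*2 t ⟩
      t + choose₂ t * 2                    ≡⟨ cong (_+_ t) (*-comm (choose₂ t) 2) ⟩
      t + (choose₂ t + (choose₂ t + 0))    ≡⟨ cong (λ x → t + (choose₂ t + x)) (+-identityʳ (choose₂ t)) ⟩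
      t + (choose₂ t + choose₂ t)          ≡⟨ +-assoc t _ _ ⟨
      choose₂ (suc t) + choose₂ t          ≡⟨ cong₂ _+_ (trans (cong binom2 (+-comm t 1)) (binom2≡choose₂ (suc t)))
                                                          (binom2≡choose₂ t) ⟨
      binom2 (t + 1) + binom2 t            ∎

module NE-2×t (t : ℕ) where

  lower upper : ℕ → ℕ
  lower = cell t 1 ∘ mirror t
  upper = cell t 0 ∘ mirror t

  NE≼-mirrored : ∀ q q′ {k k′} → k < t → k′ < t →
                 NE≼ t (cell t q (mirror t k)) (cell t q′ (mirror t k′)) ≡ (q′ ≤ᵇ q) ∧ (k ≤ᵇ k′)
  NE≼-mirrored q q′ k<t k′<t =
    trans (NE≼-cell q q′ (mirror-< k<t) (mirror-< k′<t)) (cong ((q′ ≤ᵇ q) ∧_) (mirror-≤ᵇ k<t))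

  chains : TwoChains (NE≼ t) t
  chains = record
    { lower = lower ; upper = upper
    ; lower≼lower = NE≼-mirrored 1 1 ; upper≼upper = NE≼-mirrored 0 0
    ; lower≼upper = NE≼-mirrored 1 0 ; upper⋠lower = NE≼-mirrored 0 1 }

  open TwoChainMerge chains

  lower-decreasing : ∀ {k k′} → k < k′ → k′ < t → lower k′ < lower k
  lower-decreasing k<k′ k′<t = cell-<ʳ {t} 1 (mirror-strictlyAntitone k<k′ k′<t)

  upper-decreasing : ∀ {k k′} → k < k′ → k′ < t → upper k′ < upper k
  upper-decreasing k<k′ k′<t = cell-<ʳ {t} 0 (mirror-strictlyAntitone k<k′ k′<t)

  upper<lower : ∀ {k} k′ → k < t → upper k < lower k′
  upper<lower k′ k<t = cell-<ˡ {t} {0} {1} (mirror t k′) (mirror-< k<t) ≤-refl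

  elements : segment lower 0 t ++ segment upper 0 t ↭ range1 (2 * t)
  elements = ↭-trans (++⁺ (mirrored (cell t 1)) (mirrored (cell t 0))) (rows-↭-range1 t)
    where
    mirrored : ∀ f → segment (f ∘ mirror t) 0 t ↭ segment f 0 t
    mirrored f = ↭-trans (↭-reflexive (segment-mirror f t)) (↭-reverse (segment f 0 t))

  merge-avoids-123 : ∀ {w} → Ballot t 0 0 w → avoids (1 ∷ 2 ∷ 3 ∷ []) (merge 0 0 w) ≡ true
  merge-avoids-123 b = colourSorted-avoids _>_ colour _ _ refl occurrence-123-unsorted
    (merge-colourSorted _>_ colour (λ k<t → cong (_≡ᵇ 1) (blk-cell 1 (mirror-< k<t)))
                                   (λ k<t → cong (_≡ᵇ 1) (blk-cell 0 (mirror-< k<t)))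
                        lower-decreasing upper-decreasing b)
    where
    colour = λ x → blk t x ≡ᵇ 1

  -- As in EN-2×t, plus the inversions inside the two (now decreasing) chains.
  inversions : ∀ {i j w} → Ballot t i j w →
               inv (merge i j w) + inv w ≡ choose₂ (t ∸ i) + choose₂ (t ∸ j) + (t ∸ i) * (t ∸ j)
  inversions done rewrite n∸n≡0 t = refl
  inversions {i} {j} (step₀ {w = w} j≤i i<t b) = begin
    countBelow (lower i) (merge (suc i) j w) + inv (merge (suc i) j w) + (countBelow 0 w + inv w)
      ≡⟨ cong₂ (λ c z → c + inv (merge (suc i) j w) + (z + inv w)) below-lower (countBelow-zero w) ⟩
    (t ∸ suc i) + (t ∸ j) + inv (merge (suc i) j w) + inv w
      ≡⟨ +-assoc ((t ∸ suc i) + (t ∸ j)) _ _ ⟩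
    (t ∸ suc i) + (t ∸ j) + (inv (merge (suc i) j w) + inv w)
      ≡⟨ cong (_+_ ((t ∸ suc i) + (t ∸ j))) (inversions b) ⟩
    (t ∸ suc i) + (t ∸ j) + (choose₂ (t ∸ suc i) + choose₂ (t ∸ j) + (t ∸ suc i) * (t ∸ j))
      ≡⟨ lower-step (t ∸ suc i) (t ∸ j) ⟩
    choose₂ (suc (t ∸ suc i)) + choose₂ (t ∸ j) + suc (t ∸ suc i) * (t ∸ j)
      ≡⟨ cong (λ a → choose₂ a + choose₂ (t ∸ j) + a * (t ∸ j)) (∸≡suc[∸suc] i<t) ⟨
    choose₂ (t ∸ i) + choose₂ (t ∸ j) + (t ∸ i) * (t ∸ j)
      ∎
    where
    open ≡-Reasoning
    lower-step : ∀ a b → a + b + (choose₂ a + choose₂ b + a * b) ≡ choose₂ (suc a) + choose₂ b + suc a * b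
    lower-step a b = arith a b (choose₂ a) (choose₂ b)
      where
      arith : ∀ a b x y → a + b + (x + y + a * b) ≡ (a + x) + y + suc a * b
      arith = solve-∀
    below-lower : countBelow (lower i) (merge (suc i) j w) ≡ (t ∸ suc i) + (t ∸ j)
    below-lower = trans (countBelow-merge (lower i) b) (cong₂ _+_
      (countBelow-tail-all lower (lower i) i<t (λ k i<k k<t → lower-decreasing i<k k<t))
      (countBelow-tail-all upper (lower i) (≤-trans j≤i (<⇒≤ i<t)) (λ k _ k<t → upper<lower i k<t)))
  inversions {i} {j} (step₁ {w = w} j<i b) = begin
    countBelow (upper j) (merge i (suc j) w) + inv (merge i (suc j) w) + (countBelow 1 w + inv w)
      ≡⟨ cong₂ (λ c z → c + inv (merge i (suc j) w) + (z + inv w)) below-upper (zeros-Ballot t b) ⟩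
    (t ∸ suc j) + inv (merge i (suc j) w) + ((t ∸ i) + inv w)
      ≡⟨ upper-step-assoc (t ∸ suc j) (inv (merge i (suc j) w)) (t ∸ i) (inv w) ⟩
    (t ∸ suc j) + (t ∸ i) + (inv (merge i (suc j) w) + inv w)
      ≡⟨ cong (_+_ ((t ∸ suc j) + (t ∸ i))) (inversions b) ⟩
    (t ∸ suc j) + (t ∸ i) + (choose₂ (t ∸ i) + choose₂ (t ∸ suc j) + (t ∸ i) * (t ∸ suc j))
      ≡⟨ upper-step (t ∸ i) (t ∸ suc j) ⟩
    choose₂ (t ∸ i) + choose₂ (suc (t ∸ suc j)) + (t ∸ i) * suc (t ∸ suc j)
      ≡⟨ cong (λ b → choose₂ (t ∸ i) + choose₂ b + (t ∸ i) * b) (∸≡suc[∸suc] j<t) ⟨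
    choose₂ (t ∸ i) + choose₂ (t ∸ j) + (t ∸ i) * (t ∸ j)
      ∎
    where
    open ≡-Reasoning
    i≤t = proj₂ (Ballot-≤ t b)
    j<t = <-≤-trans j<i i≤t
    upper-step-assoc : ∀ c x a y → c + x + (a + y) ≡ c + a + (x + y)
    upper-step-assoc = solve-∀
    upper-step : ∀ a b → b + a + (choose₂ a + choose₂ b + a * b) ≡ choose₂ a + choose₂ (suc b) + a * suc b
    upper-step a b = arith a b (choose₂ a) (choose₂ b)
      where
      arith : ∀ a b x y → b + a + (x + y + a * b) ≡ x + (b + y) + a * suc b
      arith = solve-∀
    below-upper : countBelow (upper j) (merge i (suc j) w) ≡ t ∸ suc j
    below-upper = trans (countBelow-merge (upper j) b) (cong₂ _+_
      (countBelow-tail-none lower (upper j) i≤t (λ k _ _ → <⇒≤ (upper<lower k j<t)))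
      (countBelow-tail-all upper (upper j) j<t (λ k j<k k<t → upper-decreasing j<k k<t)))

  generating-function : NE 2 t (1 ∷ 2 ∷ 3 ∷ []) ≈P shift (+ ((t * (3 * t ∸ 1)) / 2)) (Ctq t)
  generating-function = genfun≈shift-Ctq ((t * (3 * t ∸ 1)) / 2) (λ b → trans (inversions b) total≡)
    where
    open Enumeration (2 * t) (1 ∷ 2 ∷ 3 ∷ []) elements merge-avoids-123
    total≡ : choose₂ t + choose₂ t + t * t ≡ (t * (3 * t ∸ 1)) / 2 + binom2 t
    total≡ = begin
      choose₂ t + choose₂ t + t * t      ≡⟨ +-comm (choose₂ t + choose₂ t) (t * t) ⟩
      t * t + (choose₂ t + choose₂ t)    ≡⟨ +-assoc (t * t) _ _ ⟨
      t * t + choose₂ t + choose₂ t      ≡⟨ cong₂ _+_ (pentagonal≡square+choose₂ t) (binom2≡choose₂ t) ⟨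
      (t * (3 * t ∸ 1)) / 2 + binom2 t   ∎
      where open ≡-Reasoning

module EN-s×2 (s : ℕ) where

  lower upper : ℕ → ℕ
  lower k = cell 2 (mirror s k) 0
  upper k = cell 2 (mirror s k) 1

  EN≼-mirrored : ∀ {k k′ r r′} → k < s → r < 2 → r′ < 2 →
                 EN≼ 2 (cell 2 (mirror s k) r) (cell 2 (mirror s k′) r′) ≡ (k ≤ᵇ k′) ∧ (r ≤ᵇ r′)
  EN≼-mirrored {k} {k′} {r} {r′} k<s r<2 r′<2 =
    trans (EN≼-cell (mirror s k) (mirror s k′) r<2 r′<2) (cong (_∧ (r ≤ᵇ r′)) (mirror-≤ᵇ k<s))

  chains : TwoChains (EN≼ 2) s
  chains = record
    { lower = lower ; upper = upper
    ; lower≼lower = λ k<s _ → trans (EN≼-mirrored k<s z<s z<s) (∧-identityʳ _)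
    ; upper≼upper = λ k<s _ → trans (EN≼-mirrored k<s (s<s z<s) (s<s z<s)) (∧-identityʳ _)
    ; lower≼upper = λ k<s _ → trans (EN≼-mirrored k<s z<s (s<s z<s)) (∧-identityʳ _)
    ; upper⋠lower = λ k<s _ → trans (EN≼-mirrored k<s (s<s z<s) z<s) (∧-zeroʳ _) }

  open TwoChainMerge chains

  lower-decreasing : ∀ {k k′} → k < k′ → k′ < s → lower k′ < lower k
  lower-decreasing k<k′ k′<s = cell-<ˡ 0 z<s (mirror-strictlyAntitone k<k′ k′<s)

  upper-decreasing : ∀ {k k′} → k < k′ → k′ < s → upper k′ < upper k
  upper-decreasing k<k′ k′<s = cell-<ˡ 1 ≤-refl (mirror-strictlyAntitone k<k′ k′<s)

  lower<upper : ∀ {k k′} → k′ ≤ k → lower k < upper k′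
  lower<upper k′≤k = cell-≤-< z<s (mirror-antitone {s} k′≤k) z<s

  upper<lower : ∀ {k k′} → k < k′ → k′ < s → upper k′ < lower k
  upper<lower k<k′ k′<s = cell-<ˡ 0 ≤-refl (mirror-strictlyAntitone k<k′ k′<s)

  merge-avoids-123 : ∀ {w} → Ballot s 0 0 w → avoids (1 ∷ 2 ∷ 3 ∷ []) (merge 0 0 w) ≡ true
  merge-avoids-123 b = colourSorted-avoids _>_ colour _ _ refl occurrence-123-unsorted
    (merge-colourSorted _>_ colour (λ {k} _ → cong (_≡ᵇ 0) (pos-cell (mirror s k) z<s))
                                   (λ {k} _ → cong (_≡ᵇ 0) (pos-cell (mirror s k) ≤-refl))
                        lower-decreasing upper-decreasing b)
    where
    colour = λ x → pos 2 x ≡ᵇ 0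

  -- Pairs inside a chain and lower/upper pairs with k < k′ are always inverted; inv w counts the rest.
  inversions : ∀ {i j w} → Ballot s i j w →
               inv (merge i j w) ≡ inv w + (choose₂ (s ∸ i) + choose₂ (s ∸ i) + choose₂ (s ∸ j))
  inversions done rewrite n∸n≡0 s = refl
  inversions {i} {j} (step₀ {w = w} j≤i i<s b) = begin
    countBelow (lower i) (merge (suc i) j w) + inv (merge (suc i) j w)
      ≡⟨ cong₂ _+_ below-lower (inversions b) ⟩
    (a + a) + (inv w + (choose₂ a + choose₂ a + choose₂ (s ∸ j)))
      ≡⟨ arith a (inv w) (choose₂ a) (choose₂ (s ∸ j)) ⟩
    inv w + (choose₂ (suc a) + choose₂ (suc a) + choose₂ (s ∸ j))
      ≡⟨ cong₂ (λ z a → z + inv w + (choose₂ a + choose₂ a + choose₂ (s ∸ j)))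
               (countBelow-zero w) (∸≡suc[∸suc] i<s) ⟨
    countBelow 0 w + inv w + (choose₂ (s ∸ i) + choose₂ (s ∸ i) + choose₂ (s ∸ j))
      ∎
    where
    open ≡-Reasoning
    a = s ∸ suc i
    arith : ∀ a W x y → (a + a) + (W + (x + x + y)) ≡ W + ((a + x) + (a + x) + y)
    arith = solve-∀
    below-lower : countBelow (lower i) (merge (suc i) j w) ≡ a + a
    below-lower = trans (countBelow-merge (lower i) b) (cong₂ _+_
      (countBelow-tail-all lower (lower i) i<s (λ k i<k k<s → lower-decreasing i<k k<s))
      (countBelow-tail upper (lower i) (m≤n⇒m≤1+n j≤i) i<s
        (λ k _ k≤i → <⇒≤ (lower<upper (≤-pred k≤i)))
        (λ k i<k k<s → upper<lower i<k k<s)))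
  inversions {i} {j} (step₁ {w = w} j<i b) = begin
    countBelow (upper j) (merge i (suc j) w) + inv (merge i (suc j) w)
      ≡⟨ cong₂ _+_ below-upper (inversions b) ⟩
    ((s ∸ i) + b′) + (inv w + (choose₂ (s ∸ i) + choose₂ (s ∸ i) + choose₂ b′))
      ≡⟨ arith (s ∸ i) b′ (inv w) (choose₂ (s ∸ i)) (choose₂ b′) ⟩
    (s ∸ i) + inv w + (choose₂ (s ∸ i) + choose₂ (s ∸ i) + choose₂ (suc b′))
      ≡⟨ cong₂ (λ z b → z + inv w + (choose₂ (s ∸ i) + choose₂ (s ∸ i) + choose₂ b))
               (zeros-Ballot s b) (∸≡suc[∸suc] j<s) ⟨
    countBelow 1 w + inv w + (choose₂ (s ∸ i) + choose₂ (s ∸ i) + choose₂ (s ∸ j))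
      ∎
    where
    open ≡-Reasoning
    i≤s = proj₂ (Ballot-≤ s b)
    j<s = <-≤-trans j<i i≤s
    b′ = s ∸ suc j
    arith : ∀ a b W x y → (a + b) + (W + (x + x + y)) ≡ (a + W) + (x + x + (b + y))
    arith = solve-∀
    below-upper : countBelow (upper j) (merge i (suc j) w) ≡ (s ∸ i) + b′
    below-upper = trans (countBelow-merge (upper j) b) (cong₂ _+_
      (countBelow-tail-all lower (upper j) i≤s
        (λ k i≤k _ → lower<upper (<⇒≤ (<-≤-trans j<i i≤k))))
      (countBelow-tail-all upper (upper j) j<s (λ k j<k k<s → upper-decreasing j<k k<s)))

  generating-function : EN s 2 (1 ∷ 2 ∷ 3 ∷ []) ≈P shift (+ (3 * binom2 s)) (Cq s)
  generating-function = genfun≈shift-Cq (3 * binom2 s) (λ {w} b → trans (inversions b) (total≡ (inv w)))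
    where
    open Enumeration (s * 2) (1 ∷ 2 ∷ 3 ∷ []) (columns-↭-range1 s) merge-avoids-123
    total≡ : ∀ W → W + (choose₂ s + choose₂ s + choose₂ s) ≡ 3 * binom2 s + W
    total≡ W rewrite binom2≡choose₂ s = arith W (choose₂ s)
      where
      arith : ∀ W x → W + (x + x + x) ≡ 3 * x + W
      arith = solve-∀

module NE-s×2 (s : ℕ) where

  lower upper : ℕ → ℕ
  lower k = cell 2 (mirror s k) 1
  upper k = cell 2 (mirror s k) 0

  NE≼-mirrored : ∀ {k k′ r r′} → k < s → r < 2 → r′ < 2 →
                 NE≼ 2 (cell 2 (mirror s k) r) (cell 2 (mirror s k′) r′) ≡ (k ≤ᵇ k′) ∧ (r′ ≤ᵇ r)
  NE≼-mirrored {k} {k′} {r} {r′} k<s r<2 r′<2 =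
    trans (NE≼-cell (mirror s k) (mirror s k′) r<2 r′<2) (cong (_∧ (r′ ≤ᵇ r)) (mirror-≤ᵇ k<s))

  chains : TwoChains (NE≼ 2) s
  chains = record
    { lower = lower ; upper = upper
    ; lower≼lower = λ k<s _ → trans (NE≼-mirrored k<s (s<s z<s) (s<s z<s)) (∧-identityʳ _)
    ; upper≼upper = λ k<s _ → trans (NE≼-mirrored k<s z<s z<s) (∧-identityʳ _)
    ; lower≼upper = λ k<s _ → trans (NE≼-mirrored k<s (s<s z<s) z<s) (∧-identityʳ _)
    ; upper⋠lower = λ k<s _ → trans (NE≼-mirrored k<s z<s (s<s z<s)) (∧-zeroʳ _) }

  open TwoChainMerge chains

  lower-decreasing : ∀ {k k′} → k < k′ → k′ < s → lower k′ < lower k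
  lower-decreasing k<k′ k′<s = cell-<ˡ 1 ≤-refl (mirror-strictlyAntitone k<k′ k′<s)

  upper-decreasing : ∀ {k k′} → k < k′ → k′ < s → upper k′ < upper k
  upper-decreasing k<k′ k′<s = cell-<ˡ 0 z<s (mirror-strictlyAntitone k<k′ k′<s)

  lower<upper : ∀ {k k′} → k < k′ → k′ < s → lower k′ < upper k
  lower<upper k<k′ k′<s = cell-<ˡ 0 ≤-refl (mirror-strictlyAntitone k<k′ k′<s)

  upper<lower : ∀ {k k′} → k′ ≤ k → upper k < lower k′
  upper<lower k′≤k = cell-≤-< z<s (mirror-antitone {s} k′≤k) ≤-refl

  merge-avoids-123 : ∀ {w} → Ballot s 0 0 w → avoids (1 ∷ 2 ∷ 3 ∷ []) (merge 0 0 w) ≡ true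
  merge-avoids-123 b = colourSorted-avoids _>_ colour _ _ refl occurrence-123-unsorted
    (merge-colourSorted _>_ colour (λ {k} _ → cong (_≡ᵇ 1) (pos-cell (mirror s k) ≤-refl))
                                   (λ {k} _ → cong (_≡ᵇ 1) (pos-cell (mirror s k) z<s))
                        lower-decreasing upper-decreasing b)
    where
    colour = λ x → pos 2 x ≡ᵇ 1

  -- Pairs inside a chain and lower/upper pairs with k ≤ k′ are always inverted; inv w counts the rest.
  inversions : ∀ {i j w} → Ballot s i j w → inv (merge i j w) ≡ inv w + ((s ∸ i) * (s ∸ i) + choose₂ (s ∸ j))
  inversions done rewrite n∸n≡0 s = refl
  inversions {i} {j} (step₀ {w = w} j≤i i<s b) = begin
    countBelow (lower i) (merge (suc i) j w) + inv (merge (suc i) j w)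
      ≡⟨ cong₂ _+_ below-lower (inversions b) ⟩
    (a + suc a) + (inv w + (a * a + choose₂ (s ∸ j)))
      ≡⟨ arith a (inv w) (choose₂ (s ∸ j)) ⟩
    inv w + (suc a * suc a + choose₂ (s ∸ j))
      ≡⟨ cong₂ (λ z a → z + inv w + (a * a + choose₂ (s ∸ j))) (countBelow-zero w) (∸≡suc[∸suc] i<s) ⟨
    countBelow 0 w + inv w + ((s ∸ i) * (s ∸ i) + choose₂ (s ∸ j))
      ∎
    where
    open ≡-Reasoning
    a = s ∸ suc i
    arith : ∀ a W y → (a + suc a) + (W + (a * a + y)) ≡ W + (suc a * suc a + y)
    arith = solve-∀
    below-lower : countBelow (lower i) (merge (suc i) j w) ≡ a + suc a
    below-lower = trans (countBelow-merge (lower i) b) (cong₂ _+_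
      (countBelow-tail-all lower (lower i) i<s (λ k i<k k<s → lower-decreasing i<k k<s))
      (trans (countBelow-tail upper (lower i) j≤i (<⇒≤ i<s)
               (λ k _ k<i → <⇒≤ (lower<upper k<i i<s)) (λ k i≤k _ → upper<lower i≤k))
             (∸≡suc[∸suc] i<s)))
  inversions {i} {j} (step₁ {w = w} j<i b) = begin
    countBelow (upper j) (merge i (suc j) w) + inv (merge i (suc j) w)
      ≡⟨ cong₂ _+_ below-upper (inversions b) ⟩
    ((s ∸ i) + b′) + (inv w + ((s ∸ i) * (s ∸ i) + choose₂ b′))
      ≡⟨ arith (s ∸ i) b′ (inv w) (choose₂ b′) ⟩
    (s ∸ i) + inv w + ((s ∸ i) * (s ∸ i) + choose₂ (suc b′))
      ≡⟨ cong₂ (λ z b → z + inv w + ((s ∸ i) * (s ∸ i) + choose₂ b))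
               (zeros-Ballot s b) (∸≡suc[∸suc] j<s) ⟨
    countBelow 1 w + inv w + ((s ∸ i) * (s ∸ i) + choose₂ (s ∸ j))
      ∎
    where
    open ≡-Reasoning
    i≤s = proj₂ (Ballot-≤ s b)
    j<s = <-≤-trans j<i i≤s
    b′ = s ∸ suc j
    arith : ∀ a b W y → (a + b) + (W + (a * a + y)) ≡ (a + W) + (a * a + (b + y))
    arith = solve-∀
    below-upper : countBelow (upper j) (merge i (suc j) w) ≡ (s ∸ i) + b′
    below-upper = trans (countBelow-merge (upper j) b) (cong₂ _+_
      (countBelow-tail-all lower (upper j) i≤s (λ k i≤k k<s → lower<upper (<-≤-trans j<i i≤k) k<s))
      (countBelow-tail-all upper (upper j) j<s (λ k j<k k<s → upper-decreasing j<k k<s)))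

  generating-function : NE s 2 (1 ∷ 2 ∷ 3 ∷ []) ≈P shift (+ ((s * (3 * s ∸ 1)) / 2)) (Cq s)
  generating-function = genfun≈shift-Cq ((s * (3 * s ∸ 1)) / 2) (λ {w} b →
    trans (inversions b) (trans (+-comm (inv w) _) (cong (_+ inv w) (sym (pentagonal≡square+choose₂ s)))))
    where
    open Enumeration (s * 2) (1 ∷ 2 ∷ 3 ∷ []) (↭-trans (++-comm (segment lower 0 s) _) (columns-↭-range1 s))
                     merge-avoids-123

theorem6p1 : (s t : ℕ) → 1 ≤ s → 1 ≤ t →
    (EN 2 t (3 ∷ 2 ∷ 1 ∷ []) ≈P shift (+ binom2 (t + 1)) (Ctq t))
    × (EN s 2 (1 ∷ 2 ∷ 3 ∷ []) ≈P shift (+ (3 * binom2 s)) (Cq s))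
    × (NE s 2 (1 ∷ 2 ∷ 3 ∷ []) ≈P shift (+ ((s * (3 * s ∸ 1)) / 2)) (Cq s))
    × (NE 2 t (1 ∷ 2 ∷ 3 ∷ []) ≈P shift (+ ((t * (3 * t ∸ 1)) / 2)) (Ctq t))
theorem6p1 s t _ _ =
  EN-2×t.generating-function t , EN-s×2.generating-function s ,
  NE-s×2.generating-function s , NE-2×t.generating-function t
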